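{- Let $n\geq1$ unless another range is stated. For nonnegative integers $s_1,\dots,s_n$ write $\sigma_n=s_1+\cdots+s_n$ and $p_n(s)=\frac{\sigma_n!}{s_1!\cdots s_n!}$; all sums below are over all $n$-tuples $(s_1,\ldots,s_n)$ of nonnegative integers with $s_1+2s_2+\cdots+ns_n=n$. Then: \begin{enumerate} \item for $n\ge2$, $\sum(-1)^{\sigma_n}p_n(s)T_0^{s_1}T_1^{s_2}\cdots T_{n-1}^{s_n}=-F_{n-2}$; \item $\sum p_n(s)T_0^{s_1}T_1^{s_2}\cdots T_{n-1}^{s_n}=\left\lfloor\frac{2^n+6}{14}\right\rfloor$; \item for $n\ge2$, $\sum p_n(s)T_0^{s_1}T_2^{s_2}\cdots T_{2n-2}^{s_n}=\frac{17+\sqrt{17}}{34}\left(\frac32+\frac{\sqrt{17}}{2}\right)^{n-2}+\frac{17-\sqrt{17}}{34}\left(\frac32-\frac{\sqrt{17}}{2}\right)^{n-2}$; \item $\sum(-1)^{\sigma_n}p_n(s)T_1^{s_1}T_2^{s_2}\cdots T_n^{s_n}=-\sum_{i=0}^{\lfloor(n-2)/3\rfloor}\binom{n-2-2i}{i}$; \item for $n\ge2$, $\sum p_n(s)T_1^{s_1}T_2^{s_2}\cdots T_n^{s_n}=\sum_{i=0}^{\lfloor(2n-4)/3\rfloor}\binom{2n-4-2i}{i}$; \item $\sum(-1)^{\sigma_n}p_n(s)T_1^{s_1}T_3^{s_2}\cdots T_{2n-1}^{s_n}=-\lfloor 4\cdot 3^{n-3}\rfloor$; \item $\sum(-1)^{\sigma_n}p_n(s)T_2^{s_1}T_3^{s_2}\cdots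 T_{n+1}^{s_n}=-P_{n+2}$; \item for $n\geq4$, $\sum(-1)^{\sigma_n}p_n(s)T_3^{s_1}T_4^{s_2}\cdots T_{n+2}^{s_n}=0$; \item $\sum(-1)^{\sigma_n}p_n(s)T_3^{s_1}T_5^{s_2}\cdots T_{2n+1}^{s_n}=-2^{n-1}\sum_{i=0}^{n-1}2^{ -i-\lfloor i/2\rfloor}\binom{n-1-i}{\lfloor i/2\rfloor}$; \item for $n\ge2$, $\sum(-1)^{\sigma_n}p_n(s)T_4^{s_1}T_5^{s_2}\cdots T_{n+3}^{s_n}$ equals $1$ if $n\equiv0\pmod3$, $-1$ if $n\equiv1\pmod3$, and $0$ if $n\equiv2\pmod3$; \item for $n\geq3$, $\sum(-1)^{\sigma_n}p_n(s)T_4^{s_1}T_6^{s_2}\cdots T_{2n+2}^{s_n}=-4$; \item $\sum(-1)^{\sigma_n}p_n(s)T_5^{s_1}T_6^{s_2}\cdots T_{n+4}^{s_n}=(-1)^n\sum_{i=0}^{\lfloor(n+1)/2\rfloor}\binom{n+2+i}{n+1-2i}$; \item for $n\geq3$, $\sum(-1)^{\sigma_n}p_n(s)T_5^{s_1}T_7^{s_2}\cdots T_{2n+3}^{s_n}=4\cdot(-1)^n$. \end{enumerate}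
   Context: The tribonacci numbers are $T_0=T_1=0$, $T_2=1$, $T_n=T_{n-1}+T_{n-2}+T_{n-3}$ for $n\geq3$. The Fibonacci numbers are $F_0=0$, $F_1=1$, $F_n=F_{n-1}+F_{n-2}$. The Padovan numbers are $P_0=1$, $P_1=P_2=0$, $P_n=P_{n-2}+P_{n-3}$ for $n\ge3$. In each sum the exponent $s_k$ is attached to the $k$-th term of the displayed sequence (e.g. in $T_0^{s_1}T_2^{s_2}\cdots T_{2n-2}^{s_n}$ the factor is $T_{2k-2}^{s_k}$). -}

module Defs where

open import Data.Nat as ℕ using (ℕ; zero; suc; _+_; _*_; _∸_; _^_; NonZero; _≡ᵇ_)
open import Data.Nat.Properties using (_!≢0; m*n≢0; m^n≢0)
open import Data.Nat using (_!)
open import Data.Nat.Combinatorics using (_C_)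
open import Data.Integer as ℤ using (ℤ; +_; -[1+_])
open import Data.Rational as ℚ using (ℚ)
open import Data.List as List using (List; []; _∷_; concatMap; filterᵇ; upTo)
open import Data.Vec as Vec using (Vec; []; _∷_)
open import Data.Fin using (Fin; toℕ)
open import Data.Bool using (Bool; true; false; if_then_else_)

T : ℕ → ℕ
T 0 = 0
T 1 = 0
T 2 = 1
T (suc (suc (suc n))) = T (suc (suc n)) + T (suc n) + T n

F : ℕ → ℕ
F 0 = 0
F 1 = 1
F (suc (suc n)) = F (suc n) + F n

P : ℕ → ℕ
P 0 = 1
P 1 = 0
P 2 = 0
P (suc (suc (suc n))) = P (suc n) + P n

boxVecs : (m k : ℕ) → List (Vec ℕ k)
boxVecs m zero = [] ∷ []
boxVecs m (suc k) = concatMap (λ x → List.map (x ∷_) (boxVecs m k)) (upTo (suc m))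

weight : ∀ {k} → Vec ℕ k → ℕ
weight s = Vec.sum (Vec.zipWith _*_ (Vec.tabulate (λ (i : Fin _) → suc (toℕ i))) s)

-- every admissible tuple has all entries ≤ n, so this is the full index set
tuples : (n : ℕ) → List (Vec ℕ n)
tuples n = filterᵇ (λ s → weight s ≡ᵇ n) (boxVecs n n)

σ : ∀ {k} → Vec ℕ k → ℕ
σ s = Vec.sum s

factProd : ∀ {k} → Vec ℕ k → ℕ
factProd s = Vec.foldr _ _*_ 1 (Vec.map _! s)

factProd≢0 : ∀ {k} (s : Vec ℕ k) → NonZero (factProd s)
factProd≢0 [] = _
factProd≢0 (x ∷ s) = m*n≢0 (x !) (factProd s) {{x !≢0}} {{factProd≢0 s}}

p : ∀ {k} → Vec ℕ k → ℕ
p s = ℕ._/_ (σ s !) (factProd s) {{factProd≢0 s}}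

-- The sums.  The k-th factor (k = 1..n, i.e. i = k-1 = 0..n-1) is
-- T_{c + d*i}^{s_k}.

Tprod : (c d j : ℕ) → ∀ {k} → Vec ℕ k → ℕ
Tprod c d j [] = 1
Tprod c d j (x ∷ s) = T (c + d * j) ^ x * Tprod c d (suc j) s

sgn : ℕ → ℤ
sgn m = ℤ.-1ℤ ℤ.^ m

Sum⁺ : (c d n : ℕ) → ℤ
Sum⁺ c d n = List.foldr ℤ._+_ (+ 0)
  (List.map (λ s → + (p s * Tprod c d 0 s)) (tuples n))

Sum± : (c d n : ℕ) → ℤ
Sum± c d n = List.foldr ℤ._+_ (+ 0)
  (List.map (λ s → sgn (σ s) ℤ.* + (p s * Tprod c d 0 s)) (tuples n))

Σ< : ℕ → (ℕ → ℕ) → ℕ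
Σ< zero f = 0
Σ< (suc m) f = Σ< m f + f m

Σℚ< : ℕ → (ℕ → ℚ) → ℚ
Σℚ< zero f = ℚ.0ℚ
Σℚ< (suc m) f = Σℚ< m f ℚ.+ f m

2^-_ : ℕ → ℚ
2^- e = ℚ._/_ (+ 1) (2 ^ e) {{m^n≢0 2 e}}

-- ℤ[√17]: a + b√17 represented as ⟨ a , b ⟩

record ℤ√17 : Set where
  constructor ⟨_,_⟩
  field
    re : ℤ
    im : ℤ

_⊕_ : ℤ√17 → ℤ√17 → ℤ√17
⟨ a , b ⟩ ⊕ ⟨ c , d ⟩ = ⟨ a ℤ.+ c , b ℤ.+ d ⟩

_⊗_ : ℤ√17 → ℤ√17 → ℤ√17
⟨ a , b ⟩ ⊗ ⟨ c , d ⟩ = ⟨ a ℤ.* c ℤ.+ + 17 ℤ.* (b ℤ.* d) , a ℤ.* d ℤ.+ b ℤ.* c ⟩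

_^√_ : ℤ√17 → ℕ → ℤ√17
x ^√ zero = ⟨ + 1 , + 0 ⟩
x ^√ suc m = x ⊗ (x ^√ m)

embed : ℤ → ℤ√17
embed a = ⟨ a , + 0 ⟩

module Submission where

open import Defs

-- Idea.  Since p(s) is a multinomial coefficient, the sum counts compositions
-- of n, each part ℓ weighted by b_ℓ = ±T_{c+d(ℓ-1)}: it equals G b n, where
-- G b 0 = 1 and G b n = Σ_{ℓ=1}^{n} b_ℓ G b (n-ℓ), i.e. the coefficients of
-- 1/(1 - Σ b_ℓ x^ℓ).  The parts satisfy the tribonacci recurrence (d = 1) or
-- T_{m+6} = 3T_{m+4} + T_{m+2} + T_m (d = 2), so G b satisfies an explicit
-- linear recurrence of order three.  Each item then follows by checking that
-- the claimed closed form satisfies the same recurrence and agrees at three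
-- initial values.


module FiniteSums where

  open import Data.Nat as N using (ℕ; zero; suc; _≤_; _<_; z≤n; s≤s)
  import Data.Nat.Properties as NP
  open import Data.Integer using (ℤ; 0ℤ; 1ℤ; _+_; _*_)
  import Data.Integer.Properties as ZP
  open import Data.Integer.Tactic.RingSolver using (solve-∀)
  open import Data.Vec using (Vec; []; _∷_)
  open import Relation.Binary.PropositionalEquality
  open ≡-Reasoning

  -- Σᶻ n f = f 0 + ... + f (n-1), recursing at the front so that
  -- reindexing i ↦ suc i is definitional.
  Σᶻ : ℕ → (ℕ → ℤ) → ℤ
  Σᶻ zero f = 0ℤ
  Σᶻ (suc n) f = f 0 + Σᶻ n (λ i → f (suc i))

  Σᶻ-cong : ∀ n {f g : ℕ → ℤ} → (∀ i → f i ≡ g i) → Σᶻ n f ≡ Σᶻ n g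
  Σᶻ-cong zero e = refl
  Σᶻ-cong (suc n) e = cong₂ _+_ (e 0) (Σᶻ-cong n (λ i → e (suc i)))

  Σᶻ-cong< : ∀ n {f g : ℕ → ℤ} → (∀ i → i < n → f i ≡ g i) → Σᶻ n f ≡ Σᶻ n g
  Σᶻ-cong< zero e = refl
  Σᶻ-cong< (suc n) e = cong₂ _+_ (e 0 (s≤s z≤n)) (Σᶻ-cong< n (λ i i<n → e (suc i) (s≤s i<n)))

  Σᶻ-zero : ∀ n {f : ℕ → ℤ} → (∀ i → f i ≡ 0ℤ) → Σᶻ n f ≡ 0ℤ
  Σᶻ-zero zero e = refl
  Σᶻ-zero (suc n) e = cong₂ _+_ (e 0) (Σᶻ-zero n (λ i → e (suc i)))

  interchange : ∀ a b c d → (a + b) + (c + d) ≡ (a + c) + (b + d)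
  interchange = solve-∀

  Σᶻ-+ : ∀ n (f g : ℕ → ℤ) → Σᶻ n (λ i → f i + g i) ≡ Σᶻ n f + Σᶻ n g
  Σᶻ-+ zero f g = refl
  Σᶻ-+ (suc n) f g =
    trans (cong (_+_ (f 0 + g 0)) (Σᶻ-+ n (λ i → f (suc i)) (λ i → g (suc i))))
          (interchange (f 0) (g 0) _ _)

  Σᶻ-scale : ∀ n c (f : ℕ → ℤ) → c * Σᶻ n f ≡ Σᶻ n (λ i → c * f i)
  Σᶻ-scale zero c f = ZP.*-zeroʳ c
  Σᶻ-scale (suc n) c f =
    trans (ZP.*-distribˡ-+ c (f 0) _) (cong (_+_ (c * f 0)) (Σᶻ-scale n c (λ i → f (suc i))))

  Σᶻ-swap : ∀ n m (f : ℕ → ℕ → ℤ) →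
    Σᶻ n (λ i → Σᶻ m (λ j → f i j)) ≡ Σᶻ m (λ j → Σᶻ n (λ i → f i j))
  Σᶻ-swap zero m f = sym (Σᶻ-zero m (λ _ → refl))
  Σᶻ-swap (suc n) m f = begin
    Σᶻ m (f 0) + Σᶻ n (λ i → Σᶻ m (f (suc i)))  ≡⟨ cong (_+_ (Σᶻ m (f 0))) (Σᶻ-swap n m (λ i → f (suc i))) ⟩
    Σᶻ m (f 0) + Σᶻ m (λ j → Σᶻ n (λ i → f (suc i) j)) ≡⟨ sym (Σᶻ-+ m _ _) ⟩
    Σᶻ m (λ j → f 0 j + Σᶻ n (λ i → f (suc i) j)) ∎

  Σᶻ-snoc : ∀ n (f : ℕ → ℤ) → Σᶻ (suc n) f ≡ Σᶻ n f + f n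
  Σᶻ-snoc zero f = trans (ZP.+-identityʳ (f 0)) (sym (ZP.+-identityˡ (f 0)))
  Σᶻ-snoc (suc n) f =
    trans (cong (_+_ (f 0)) (Σᶻ-snoc n (λ i → f (suc i)))) (sym (ZP.+-assoc (f 0) _ _))

  Σᶻ-truncate : ∀ m N (f : ℕ → ℤ) → (∀ x → m < x → f x ≡ 0ℤ) → m < N → Σᶻ N f ≡ Σᶻ (suc m) f
  Σᶻ-truncate zero (suc N) f z _ = cong (_+_ (f 0)) (Σᶻ-zero N (λ i → z (suc i) (s≤s z≤n)))
  Σᶻ-truncate (suc m) (suc N) f z (s≤s m<N) =
    cong (_+_ (f 0)) (Σᶻ-truncate m N (λ i → f (suc i)) (λ x m<x → z (suc x) (s≤s m<x)) m<N)

  δ : ℕ → ℕ → ℤ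
  δ zero zero = 1ℤ
  δ zero (suc n) = 0ℤ
  δ (suc a) zero = 0ℤ
  δ (suc a) (suc n) = δ a n

  Σᶻ-δ : ∀ a N → a < N → Σᶻ N (δ a) ≡ 1ℤ
  Σᶻ-δ zero (suc N) _ = cong (_+_ 1ℤ) (Σᶻ-zero N (λ _ → refl))
  Σᶻ-δ (suc a) (suc N) (s≤s a<N) = trans (ZP.+-identityˡ _) (Σᶻ-δ a N a<N)

  -- shift w f n = f (n - w) when w ≤ n, and 0 otherwise: multiplication
  -- of a generating function by x^w.
  shift : ℕ → (ℕ → ℤ) → ℕ → ℤ
  shift zero f n = f n
  shift (suc w) f zero = 0ℤ
  shift (suc w) f (suc n) = shift w f n

  shift-zero : ∀ w n → shift w (λ _ → 0ℤ) n ≡ 0ℤ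
  shift-zero zero n = refl
  shift-zero (suc w) zero = refl
  shift-zero (suc w) (suc n) = shift-zero w n

  shift-cong≡ : ∀ w n {f g : ℕ → ℤ} → (∀ n' → w N.+ n' ≡ n → f n' ≡ g n') → shift w f n ≡ shift w g n
  shift-cong≡ zero n e = e n refl
  shift-cong≡ (suc w) zero e = refl
  shift-cong≡ (suc w) (suc n) e = shift-cong≡ w n (λ n' eq → e n' (cong suc eq))

  shift-cong : ∀ w n {f g : ℕ → ℤ} → (∀ n' → f n' ≡ g n') → shift w f n ≡ shift w g n
  shift-cong w n e = shift-cong≡ w n (λ n' _ → e n')

  shift-vanish : ∀ w n (f : ℕ → ℤ) → (∀ n' → w N.+ n' ≡ n → f n' ≡ 0ℤ) → shift w f n ≡ 0ℤ
  shift-vanish w n f e = trans (shift-cong≡ w n e) (shift-zero w n)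

  shift-below : ∀ w n (f : ℕ → ℤ) → n < w → shift w f n ≡ 0ℤ
  shift-below (suc w) zero f _ = refl
  shift-below (suc w) (suc n) f (s≤s n<w) = shift-below w n f n<w

  shift-scale : ∀ w n c (f : ℕ → ℤ) → c * shift w f n ≡ shift w (λ n' → c * f n') n
  shift-scale zero n c f = refl
  shift-scale (suc w) zero c f = ZP.*-zeroʳ c
  shift-scale (suc w) (suc n) c f = shift-scale w n c f

  shift-+ : ∀ w n (f g : ℕ → ℤ) → shift w f n + shift w g n ≡ shift w (λ n' → f n' + g n') n
  shift-+ zero n f g = refl
  shift-+ (suc w) zero f g = refl
  shift-+ (suc w) (suc n) f g = shift-+ w n f g

  shift-Σᶻ : ∀ w n N (F : ℕ → ℕ → ℤ) →
    shift w (λ n' → Σᶻ N (λ i → F i n')) n ≡ Σᶻ N (λ i → shift w (F i) n)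
  shift-Σᶻ zero n N F = refl
  shift-Σᶻ (suc w) zero N F = sym (Σᶻ-zero N (λ _ → refl))
  shift-Σᶻ (suc w) (suc n) N F = shift-Σᶻ w n N F

  shift-shift : ∀ a b n (f : ℕ → ℤ) → shift a (λ u → shift b f u) n ≡ shift (a N.+ b) f n
  shift-shift zero b n f = refl
  shift-shift (suc a) b zero f = refl
  shift-shift (suc a) b (suc n) f = shift-shift a b n f

  shift-comm : ∀ a n c m (G : ℕ → ℕ → ℤ) →
    shift a (λ u → shift c (λ v → G u v) m) n ≡ shift c (λ v → shift a (λ u → G u v) n) m
  shift-comm zero n c m G = refl
  shift-comm (suc a) zero c m G = sym (shift-zero c m)
  shift-comm (suc a) (suc n) c m G = shift-comm a n c m G

  shift-suc : ∀ y m (g : ℕ → ℤ) → g 0 ≡ 0ℤ → shift (suc y) (λ m' → g (suc m')) m ≡ shift y g m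
  shift-suc zero zero g g0 = sym g0
  shift-suc zero (suc m) g g0 = refl
  shift-suc (suc y) zero g g0 = refl
  shift-suc (suc y) (suc m) g g0 = shift-suc y m g g0

  δ-swap : ∀ a n (h : ℕ → ℤ) → δ a n * h a ≡ δ a n * h n
  δ-swap zero zero h = refl
  δ-swap zero (suc n) h = trans (ZP.*-zeroˡ (h 0)) (sym (ZP.*-zeroˡ (h (suc n))))
  δ-swap (suc a) zero h = trans (ZP.*-zeroˡ (h (suc a))) (sym (ZP.*-zeroˡ (h 0)))
  δ-swap (suc a) (suc n) h = δ-swap a n (λ z → h (suc z))

  δ-shift : ∀ w a n (h : ℕ → ℤ) → δ (w N.+ a) n * h a ≡ shift w (λ n' → δ a n' * h n') n
  δ-shift zero a n h = δ-swap a n h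
  δ-shift (suc w) a zero h = ZP.*-zeroˡ (h a)
  δ-shift (suc w) a (suc n) h = δ-shift w a n h

  Σrange : ℕ → ℕ → (ℕ → ℤ) → ℤ
  Σrange j zero g = 0ℤ
  Σrange j (suc k) g = g (suc j) + Σrange (suc j) k g

  Σrange-cong : ∀ j k {f g : ℕ → ℤ} → (∀ ℓ → j < ℓ → f ℓ ≡ g ℓ) → Σrange j k f ≡ Σrange j k g
  Σrange-cong j zero e = refl
  Σrange-cong j (suc k) e =
    cong₂ _+_ (e (suc j) NP.≤-refl) (Σrange-cong (suc j) k (λ ℓ lt → e ℓ (NP.<-trans (NP.n<1+n j) lt)))

  Σrange-zero : ∀ j k {f : ℕ → ℤ} → (∀ ℓ → j < ℓ → f ℓ ≡ 0ℤ) → Σrange j k f ≡ 0ℤ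
  Σrange-zero j zero e = refl
  Σrange-zero j (suc k) e =
    cong₂ _+_ (e (suc j) NP.≤-refl) (Σrange-zero (suc j) k (λ ℓ lt → e ℓ (NP.<-trans (NP.n<1+n j) lt)))

  Σrange-scale : ∀ j k c (f : ℕ → ℤ) → c * Σrange j k f ≡ Σrange j k (λ ℓ → c * f ℓ)
  Σrange-scale j zero c f = ZP.*-zeroʳ c
  Σrange-scale j (suc k) c f =
    trans (ZP.*-distribˡ-+ c (f (suc j)) _) (cong (_+_ (c * f (suc j))) (Σrange-scale (suc j) k c f))

  Σrange-+ : ∀ j k (f g : ℕ → ℤ) → Σrange j k (λ ℓ → f ℓ + g ℓ) ≡ Σrange j k f + Σrange j k g
  Σrange-+ j zero f g = refl
  Σrange-+ j (suc k) f g =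
    trans (cong (_+_ (f (suc j) + g (suc j))) (Σrange-+ (suc j) k f g))
          (interchange (f (suc j)) (g (suc j)) (Σrange (suc j) k f) (Σrange (suc j) k g))

  Σrange-Σᶻ : ∀ j k N (F : ℕ → ℕ → ℤ) →
    Σrange j k (λ ℓ → Σᶻ N (λ i → F i ℓ)) ≡ Σᶻ N (λ i → Σrange j k (F i))
  Σrange-Σᶻ j zero N F = sym (Σᶻ-zero N (λ _ → refl))
  Σrange-Σᶻ j (suc k) N F =
    trans (cong (_+_ (Σᶻ N (λ i → F i (suc j)))) (Σrange-Σᶻ (suc j) k N F)) (sym (Σᶻ-+ N _ _))

  shift-Σrange : ∀ w n j k (F : ℕ → ℕ → ℤ) →
    shift w (λ n' → Σrange j k (λ ℓ → F ℓ n')) n ≡ Σrange j k (λ ℓ → shift w (F ℓ) n)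
  shift-Σrange zero n j k F = refl
  shift-Σrange (suc w) zero j k F = sym (Σrange-zero j k (λ _ _ → refl))
  shift-Σrange (suc w) (suc n) j k F = shift-Σrange w n j k F

  Σrange-suc : ∀ j k (f : ℕ → ℤ) → Σrange (suc j) k f ≡ Σrange j k (λ ℓ → f (suc ℓ))
  Σrange-suc j zero f = refl
  Σrange-suc j (suc k) f = cong (_+_ (f (suc (suc j)))) (Σrange-suc (suc j) k f)

  Σrange-split : ∀ j a b (f : ℕ → ℤ) → Σrange j (a N.+ b) f ≡ Σrange j a f + Σrange (j N.+ a) b f
  Σrange-split j zero b f rewrite NP.+-identityʳ j = sym (ZP.+-identityˡ _)
  Σrange-split j (suc a) b f = begin
    f (suc j) + Σrange (suc j) (a N.+ b) f
      ≡⟨ cong (_+_ (f (suc j))) (Σrange-split (suc j) a b f) ⟩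
    f (suc j) + (Σrange (suc j) a f + Σrange (suc j N.+ a) b f)
      ≡⟨ sym (ZP.+-assoc (f (suc j)) _ _) ⟩
    f (suc j) + Σrange (suc j) a f + Σrange (suc j N.+ a) b f
      ≡⟨ cong (λ z → f (suc j) + Σrange (suc j) a f + Σrange z b f) (sym (NP.+-suc j a)) ⟩
    f (suc j) + Σrange (suc j) a f + Σrange (j N.+ suc a) b f ∎

  Σrange-truncate : ∀ K N (g : ℕ → ℤ) → N ≤ K → (∀ ℓ → N < ℓ → g ℓ ≡ 0ℤ) → Σrange 0 K g ≡ Σrange 0 N g
  Σrange-truncate K N g N≤K z = begin
    Σrange 0 K g                                  ≡⟨ cong (λ t → Σrange 0 t g) (sym (NP.m+[n∸m]≡n N≤K)) ⟩
    Σrange 0 (N N.+ (K N.∸ N)) g                  ≡⟨ Σrange-split 0 N (K N.∸ N) g ⟩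
    Σrange 0 N g + Σrange N (K N.∸ N) g           ≡⟨ cong (_+_ (Σrange 0 N g)) (Σrange-zero N (K N.∸ N) z) ⟩
    Σrange 0 N g + 0ℤ                             ≡⟨ ZP.+-identityʳ _ ⟩
    Σrange 0 N g ∎

  Σbox : (M k : ℕ) → (Vec ℕ k → ℤ) → ℤ
  Σbox M zero g = g []
  Σbox M (suc k) g = Σᶻ (suc M) (λ x → Σbox M k (λ v → g (x ∷ v)))

  Σbox-cong : ∀ M k {f g : Vec ℕ k → ℤ} → (∀ v → f v ≡ g v) → Σbox M k f ≡ Σbox M k g
  Σbox-cong M zero e = e []
  Σbox-cong M (suc k) e = Σᶻ-cong (suc M) (λ x → Σbox-cong M k (λ v → e (x ∷ v)))

  Σbox-zero : ∀ M k {f : Vec ℕ k → ℤ} → (∀ v → f v ≡ 0ℤ) → Σbox M k f ≡ 0ℤ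
  Σbox-zero M zero e = e []
  Σbox-zero M (suc k) e = Σᶻ-zero (suc M) (λ x → Σbox-zero M k (λ v → e (x ∷ v)))

  Σbox-scale : ∀ M k c (f : Vec ℕ k → ℤ) → c * Σbox M k f ≡ Σbox M k (λ v → c * f v)
  Σbox-scale M zero c f = refl
  Σbox-scale M (suc k) c f =
    trans (Σᶻ-scale (suc M) c (λ x → Σbox M k (λ v → f (x ∷ v))))
          (Σᶻ-cong (suc M) (λ x → Σbox-scale M k c (λ v → f (x ∷ v))))

  Σbox-Σᶻ : ∀ M k N (F : ℕ → Vec ℕ k → ℤ) →
    Σbox M k (λ v → Σᶻ N (λ i → F i v)) ≡ Σᶻ N (λ i → Σbox M k (F i))
  Σbox-Σᶻ M zero N F = refl
  Σbox-Σᶻ M (suc k) N F =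
    trans (Σᶻ-cong (suc M) (λ x → Σbox-Σᶻ M k N (λ i v → F i (x ∷ v))))
          (Σᶻ-swap (suc M) N (λ x i → Σbox M k (λ v → F i (x ∷ v))))

  shift-Σbox : ∀ w n M k (F : Vec ℕ k → ℕ → ℤ) →
    shift w (λ n' → Σbox M k (λ v → F v n')) n ≡ Σbox M k (λ v → shift w (F v) n)
  shift-Σbox zero n M k F = refl
  shift-Σbox (suc w) zero M k F = sym (Σbox-zero M k (λ _ → refl))
  shift-Σbox (suc w) (suc n) M k F = shift-Σbox w n M k F


-- For a sequence b = (b₁, b₂, ...) the sum
--   Σ_{s : 1·s₁ + 2·s₂ + ... + k·s_k = n} (σ s)!/(s₁!⋯s_k!) · b₁^{s₁}⋯b_k^{s_k}
-- (k ≥ n) equals G b n, where G b 0 = 1 and G b n = Σ_{ℓ=1}^{n} b_ℓ · G b (n-ℓ):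
-- both count compositions of n weighted by the product of their parts' b-values.
-- We refine by the number m = σ s of parts (the two-variable array U) and prove
-- that U satisfies "remove the first part" (U-peel), then sum over m.
module Compositions where

  open FiniteSums
  open import Data.Nat as N using (ℕ; zero; suc; _≤_; _<_; z≤n; s≤s)
  import Data.Nat.Properties as NP
  open import Data.Nat.Combinatorics using (_C_; k>n⇒nCk≡0; nCk+nC[k+1]≡[n+1]C[k+1])
  open import Data.Integer using (ℤ; +_; 0ℤ; 1ℤ; _+_; _*_; _^_)
  import Data.Integer.Properties as ZP
  open import Data.Integer.Tactic.RingSolver using (solve-∀)
  open import Data.Vec using (Vec; []; _∷_)
  open import Relation.Binary.PropositionalEquality
  open ≡-Reasoning

  -- the multinomial coefficient (σ v)! / Π (v_i)!, as a product of binomials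
  multinom : ∀ {k} → Vec ℕ k → ℕ
  multinom [] = 1
  multinom (x ∷ v) = ((x N.+ σ v) C x) N.* multinom v

  wt : ∀ {k} → ℕ → Vec ℕ k → ℕ
  wt j [] = 0
  wt j (x ∷ v) = suc j N.* x N.+ wt (suc j) v

  monomial : (ℕ → ℤ) → ∀ {k} → ℕ → Vec ℕ k → ℤ
  monomial b j [] = 1ℤ
  monomial b j (x ∷ v) = b (suc j) ^ x * monomial b (suc j) v

  term : (ℕ → ℤ) → ∀ {k} → ℕ → Vec ℕ k → ℤ
  term b j v = + multinom v * monomial b j v

  Ubox : (ℕ → ℤ) → (j k M n m : ℕ) → ℤ
  Ubox b j k M n m = Σbox M k (λ v → δ (wt j v) n * (δ (σ v) m * term b j v))

  -- weight of x parts of size j+1 among m' + x parts in total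
  coef : (ℕ → ℤ) → (j x m' : ℕ) → ℤ
  coef b j x m' = + ((x N.+ m') C x) * b (suc j) ^ x

  -- the same quantity, defined by recursion on the first entry (without box bound)
  U : (ℕ → ℤ) → (j k n m : ℕ) → ℤ
  U b j zero n m = δ 0 n * δ 0 m
  U b j (suc k) n m = Σᶻ (suc m) (λ x → slice x)
    where
    slice : ℕ → ℤ
    slice x = shift (suc j N.* x) (λ n' → shift x (λ m' → coef b j x m' * U b (suc j) k n' m') m) n

  module _ (b : ℕ → ℤ) (j : ℕ) where
    private
      w = suc j
      β = b (suc j)

    cell : ∀ {k} → Vec ℕ k → ℕ → ℕ → ℤ
    cell v n' m' = δ (wt (suc j) v) n' * (δ (σ v) m' * term b (suc j) v)

    cell-cons : ∀ {k} x (v : Vec ℕ k) n m →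
      δ (wt j (x ∷ v)) n * (δ (σ (x ∷ v)) m * term b j (x ∷ v))
        ≡ shift (w N.* x) (λ n' → shift x (λ m' → coef b j x m' * cell v n' m') m) n
    cell-cons x v n m = begin
      δ (w N.* x N.+ wt w v) n * (δ (x N.+ σ v) m * S (σ v))
        ≡⟨ δ-shift (w N.* x) (wt w v) n (λ _ → δ (x N.+ σ v) m * S (σ v)) ⟩
      shift (w N.* x) (λ n' → δ (wt w v) n' * (δ (x N.+ σ v) m * S (σ v))) n
        ≡⟨ shift-cong (w N.* x) n inner ⟩
      shift (w N.* x) (λ n' → shift x (λ m' → coef b j x m' * cell v n' m') m) n ∎
      where
      S : ℕ → ℤ
      S t = + (((x N.+ t) C x) N.* multinom v) * (β ^ x * monomial b w v)
      regroup : ∀ A B c q P Q → A * (B * (c * q * (P * Q))) ≡ (c * P) * (A * (B * (q * Q)))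
      regroup = solve-∀
      inner : ∀ n' → δ (wt w v) n' * (δ (x N.+ σ v) m * S (σ v))
                   ≡ shift x (λ m' → coef b j x m' * cell v n' m') m
      inner n' = begin
        δ (wt w v) n' * (δ (x N.+ σ v) m * S (σ v))  ≡⟨ cong (δ (wt w v) n' *_) (δ-shift x (σ v) m S) ⟩
        δ (wt w v) n' * shift x (λ m' → δ (σ v) m' * S m') m  ≡⟨ shift-scale x m (δ (wt w v) n') _ ⟩
        shift x (λ m' → δ (wt w v) n' * (δ (σ v) m' * S m')) m
          ≡⟨ shift-cong x m (λ m' → trans
               (cong (λ z → δ (wt w v) n' * (δ (σ v) m' * (z * (β ^ x * monomial b w v))))
                     (ZP.pos-* ((x N.+ m') C x) (multinom v)))
               (regroup (δ (wt w v) n') (δ (σ v) m') (+ ((x N.+ m') C x)) (+ multinom v) (β ^ x) (monomial b w v))) ⟩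
        shift x (λ m' → coef b j x m' * cell v n' m') m ∎

    Ubox-cons : ∀ k M n m → Ubox b j (suc k) M n m
      ≡ Σᶻ (suc M) (λ x → shift (w N.* x) (λ n' → shift x (λ m' → coef b j x m' * Ubox b (suc j) k M n' m') m) n)
    Ubox-cons k M n m = Σᶻ-cong (suc M) (λ x → begin
      Σbox M k (λ v → δ (wt j (x ∷ v)) n * (δ (σ (x ∷ v)) m * term b j (x ∷ v)))
        ≡⟨ Σbox-cong M k (λ v → cell-cons x v n m) ⟩
      Σbox M k (λ v → shift (w N.* x) (λ n' → shift x (λ m' → coef b j x m' * cell v n' m') m) n)
        ≡⟨ sym (shift-Σbox (w N.* x) n M k (λ v n' → shift x (λ m' → coef b j x m' * cell v n' m') m)) ⟩
      shift (w N.* x) (λ n' → Σbox M k (λ v → shift x (λ m' → coef b j x m' * cell v n' m') m)) n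
        ≡⟨ shift-cong (w N.* x) n (λ n' → trans
             (sym (shift-Σbox x m M k (λ v m' → coef b j x m' * cell v n' m')))
             (shift-cong x m (λ m' → sym (Σbox-scale M k (coef b j x m') (λ v → cell v n' m'))))) ⟩
      shift (w N.* x) (λ n' → shift x (λ m' → coef b j x m' * Ubox b (suc j) k M n' m') m) n ∎)

  module _ (b : ℕ → ℤ) where

    Ubox≡U : ∀ j k M n m → m ≤ M → Ubox b j k M n m ≡ U b j k n m
    Ubox≡U j zero M n m m≤M = cong (δ 0 n *_) (ZP.*-identityʳ (δ 0 m))
    Ubox≡U j (suc k) M n m m≤M = begin
      Ubox b j (suc k) M n m  ≡⟨ Ubox-cons b j k M n m ⟩
      Σᶻ (suc M) slice        ≡⟨ Σᶻ-truncate m (suc M) slice vanish (s≤s m≤M) ⟩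
      Σᶻ (suc m) slice
        ≡⟨ Σᶻ-cong (suc m) (λ x → shift-cong (suc j N.* x) n (λ n' → shift-cong≡ x m (λ m' eq →
             cong (coef b j x m' *_)
                  (Ubox≡U (suc j) k M n' m' (NP.≤-trans (NP.m≤n+m m' x) (NP.≤-trans (NP.≤-reflexive eq) m≤M)))))) ⟩
      U b j (suc k) n m ∎
      where
      slice : ℕ → ℤ
      slice x = shift (suc j N.* x) (λ n' → shift x (λ m' → coef b j x m' * Ubox b (suc j) k M n' m') m) n
      vanish : ∀ x → m < x → slice x ≡ 0ℤ
      vanish x m<x = shift-vanish (suc j N.* x) n _ (λ n' _ → shift-below x m _ m<x)

    shift-by-0 : ∀ w n (f : ℕ → ℤ) → shift (w N.* 0) f n ≡ f n
    shift-by-0 w n f = cong (λ z → shift z f n) (NP.*-zeroʳ w)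

    U-no-parts : ∀ j k n → U b j k n 0 ≡ δ 0 n
    U-no-parts j zero n = ZP.*-identityʳ (δ 0 n)
    U-no-parts j (suc k) n = begin
      shift (suc j N.* 0) (λ n' → coef b j 0 0 * U b (suc j) k n' 0) n + 0ℤ  ≡⟨ ZP.+-identityʳ _ ⟩
      shift (suc j N.* 0) (λ n' → coef b j 0 0 * U b (suc j) k n' 0) n       ≡⟨ shift-by-0 (suc j) n _ ⟩
      1ℤ * U b (suc j) k n 0                                                  ≡⟨ ZP.*-identityˡ _ ⟩
      U b (suc j) k n 0                                                       ≡⟨ U-no-parts (suc j) k n ⟩
      δ 0 n ∎

    -- The slice x collects the vectors with first entry x; Pascal's rule
    -- C(y+1+m', y+1) = C(y+m', y) + C(y+m', y+1) splits slice (suc y) into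
    -- a part "the first part has size j+1" (sliceHead) and the rest (sliceTail).
    module PeelStep (j k n m : ℕ) where
      w = suc j
      β = b (suc j)
      U' = U b (suc j) k
      co = coef b j

      slice : ℕ → ℤ
      slice x = shift (w N.* x) (λ n' → shift x (λ m' → co x m' * U' n' m') (suc m)) n

      sliceHead sliceTail : ℕ → ℤ
      sliceHead y = shift (w N.* suc y) (λ n' → shift y (λ m' → (+ ((y N.+ m') C y) * β ^ suc y) * U' n' m') m) n
      sliceTail y = shift (w N.* suc y) (λ n' → shift y (λ m' → (+ ((y N.+ m') C suc y) * β ^ suc y) * U' n' m') m) n

      slice-0 : slice 0 ≡ U' n (suc m)
      slice-0 = trans (shift-by-0 w n _) (ZP.*-identityˡ _)

      slice-pascal : ∀ y → slice (suc y) ≡ sliceHead y + sliceTail y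
      slice-pascal y =
        trans (shift-cong (w N.* suc y) n (λ n' →
                 trans (shift-cong y m (λ m' → pascal (U' n' m') ((y N.+ m') C y) ((y N.+ m') C suc y)
                                                 (sym (nCk+nC[k+1]≡[n+1]C[k+1] (y N.+ m') y))))
                       (sym (shift-+ y m _ _))))
              (sym (shift-+ (w N.* suc y) n _ _))
        where
        distrib : ∀ a c u → (+ a + + c) * β ^ suc y * u ≡ + a * β ^ suc y * u + + c * β ^ suc y * u
        distrib a c u = solve-∀′ (+ a) (+ c) (β ^ suc y) u
          where
          solve-∀′ : ∀ a c p u → (a + c) * p * u ≡ a * p * u + c * p * u
          solve-∀′ = solve-∀
        pascal : ∀ u a c {t} → t ≡ a N.+ c → + t * β ^ suc y * u ≡ + a * β ^ suc y * u + + c * β ^ suc y * u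
        pascal u a c refl = trans (cong (λ z → z * β ^ suc y * u) (ZP.pos-+ a c)) (distrib a c u)

      -- C(m, m+1) = 0: the last tail slice is empty
      sliceTail-last : sliceTail m ≡ 0ℤ
      sliceTail-last = shift-vanish (w N.* suc m) n _ (λ n' _ → shift-vanish m m _ (λ m' eq →
        trans (cong (λ z → (+ ((m N.+ z) C suc m) * β ^ suc m) * U' n' z) (NP.+-cancelˡ-≡ m _ 0 (trans eq (sym (NP.+-identityʳ m)))))
        (trans (cong (λ z → (+ z * β ^ suc m) * U' n' 0)
                     (trans (cong (_C suc m) (NP.+-identityʳ m)) (k>n⇒nCk≡0 (NP.n<1+n m))))
               (ZP.*-zeroˡ (U' n' 0)))))

      Σ-sliceHead : β * shift w (λ n' → U b j (suc k) n' m) n ≡ Σᶻ (suc m) sliceHead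
      Σ-sliceHead = begin
        β * shift w (λ n' → Σᶻ (suc m) (λ x → Y x n')) n  ≡⟨ cong (β *_) (shift-Σᶻ w n (suc m) Y) ⟩
        β * Σᶻ (suc m) (λ x → shift w (Y x) n)            ≡⟨ Σᶻ-scale (suc m) β (λ x → shift w (Y x) n) ⟩
        Σᶻ (suc m) (λ x → β * shift w (Y x) n)            ≡⟨ Σᶻ-cong (suc m) head ⟩
        Σᶻ (suc m) sliceHead ∎
        where
        Y : ℕ → ℕ → ℤ
        Y x n' = shift (w N.* x) (λ n'' → shift x (λ m' → co x m' * U' n'' m') m) n'
        absorb : ∀ β c P u → β * ((c * P) * u) ≡ (c * (β * P)) * u
        absorb = solve-∀
        head : ∀ x → β * shift w (Y x) n ≡ sliceHead x
        head x = begin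
          β * shift w (Y x) n  ≡⟨ cong (β *_) (shift-shift w (w N.* x) n _) ⟩
          β * shift (w N.+ w N.* x) (λ n'' → shift x (λ m' → co x m' * U' n'' m') m) n
            ≡⟨ cong (λ z → β * shift z (λ n'' → shift x (λ m' → co x m' * U' n'' m') m) n) (sym (NP.*-suc w x)) ⟩
          β * shift (w N.* suc x) (λ n'' → shift x (λ m' → co x m' * U' n'' m') m) n
            ≡⟨ shift-scale (w N.* suc x) n β _ ⟩
          shift (w N.* suc x) (λ n'' → β * shift x (λ m' → co x m' * U' n'' m') m) n
            ≡⟨ shift-cong (w N.* suc x) n (λ n'' → trans (shift-scale x m β _)
                 (shift-cong x m (λ m' → absorb β (+ ((x N.+ m') C x)) (β ^ x) (U' n'' m')))) ⟩
          sliceHead x ∎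

      -- The remaining parts (sizes j+2, ..., j+k+1) contribute, by the
      -- induction hypothesis at level j+1, the slice 0 and the tail slices.
      module _ (IH : ∀ n' m' → U' n' (suc m') ≡ Σrange (suc j) k (λ ℓ → b ℓ * shift ℓ (λ n'' → U' n'' m') n')) where

        Z : ℕ → ℕ → ℤ
        Z x n'' = shift x (λ m' → co x m' * U' n'' m') m

        inner-slice : ∀ x n' m' →
          Σrange (suc j) k (λ ℓ → b ℓ * shift ℓ (λ n'' → co x m' * U' n'' m') n') ≡ co x m' * U' n' (suc m')
        inner-slice x n' m' = begin
          Σrange (suc j) k (λ ℓ → b ℓ * shift ℓ (λ n'' → co x m' * U' n'' m') n')
            ≡⟨ Σrange-cong (suc j) k (λ ℓ _ → trans (cong (b ℓ *_) (sym (shift-scale ℓ n' (co x m') _)))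
                 (swap (co x m') (b ℓ) _)) ⟩
          Σrange (suc j) k (λ ℓ → co x m' * (b ℓ * shift ℓ (λ n'' → U' n'' m') n'))
            ≡⟨ sym (Σrange-scale (suc j) k (co x m') _) ⟩
          co x m' * Σrange (suc j) k (λ ℓ → b ℓ * shift ℓ (λ n'' → U' n'' m') n')
            ≡⟨ cong (co x m' *_) (sym (IH n' m')) ⟩
          co x m' * U' n' (suc m') ∎
          where
          swap : ∀ c b s → b * (c * s) ≡ c * (b * s)
          swap = solve-∀

        tail-slice : ∀ x →
          Σrange (suc j) k (λ ℓ → b ℓ * shift ℓ (λ n' → shift (w N.* x) (Z x) n') n)
            ≡ shift (w N.* x) (λ n' → shift x (λ m' → co x m' * U' n' (suc m')) m) n
        tail-slice x = begin
          Σrange (suc j) k (λ ℓ → b ℓ * shift ℓ (λ n' → shift (w N.* x) (Z x) n') n)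
            ≡⟨ Σrange-cong (suc j) k (λ ℓ _ → begin
                 b ℓ * shift ℓ (λ n' → shift (w N.* x) (Z x) n') n  ≡⟨ cong (b ℓ *_) (shift-shift ℓ (w N.* x) n (Z x)) ⟩
                 b ℓ * shift (ℓ N.+ w N.* x) (Z x) n  ≡⟨ cong (λ z → b ℓ * shift z (Z x) n) (NP.+-comm ℓ (w N.* x)) ⟩
                 b ℓ * shift (w N.* x N.+ ℓ) (Z x) n  ≡⟨ cong (b ℓ *_) (sym (shift-shift (w N.* x) ℓ n (Z x))) ⟩
                 b ℓ * shift (w N.* x) (λ n' → shift ℓ (Z x) n') n  ≡⟨ shift-scale (w N.* x) n (b ℓ) _ ⟩
                 shift (w N.* x) (λ n' → b ℓ * shift ℓ (Z x) n') n ∎) ⟩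
          Σrange (suc j) k (λ ℓ → shift (w N.* x) (λ n' → b ℓ * shift ℓ (Z x) n') n)
            ≡⟨ sym (shift-Σrange (w N.* x) n (suc j) k (λ ℓ n' → b ℓ * shift ℓ (Z x) n')) ⟩
          shift (w N.* x) (λ n' → Σrange (suc j) k (λ ℓ → b ℓ * shift ℓ (Z x) n')) n
            ≡⟨ shift-cong (w N.* x) n (λ n' → begin
                 Σrange (suc j) k (λ ℓ → b ℓ * shift ℓ (Z x) n')
                   ≡⟨ Σrange-cong (suc j) k (λ ℓ _ →
                        trans (cong (b ℓ *_) (shift-comm ℓ n' x m (λ n'' m' → co x m' * U' n'' m')))
                              (shift-scale x m (b ℓ) _)) ⟩
                 Σrange (suc j) k (λ ℓ → shift x (λ m' → b ℓ * shift ℓ (λ n'' → co x m' * U' n'' m') n') m)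
                   ≡⟨ sym (shift-Σrange x m (suc j) k (λ ℓ m' → b ℓ * shift ℓ (λ n'' → co x m' * U' n'' m') n')) ⟩
                 shift x (λ m' → Σrange (suc j) k (λ ℓ → b ℓ * shift ℓ (λ n'' → co x m' * U' n'' m') n')) m
                   ≡⟨ shift-cong x m (inner-slice x n') ⟩
                 shift x (λ m' → co x m' * U' n' (suc m')) m ∎) ⟩
          shift (w N.* x) (λ n' → shift x (λ m' → co x m' * U' n' (suc m')) m) n ∎

        Σ-sliceTail : Σrange (suc j) k (λ ℓ → b ℓ * shift ℓ (λ n' → U b j (suc k) n' m) n)
                        ≡ U' n (suc m) + Σᶻ m sliceTail
        Σ-sliceTail = begin
          Σrange (suc j) k (λ ℓ → b ℓ * shift ℓ (λ n' → Σᶻ (suc m) (λ x → shift (w N.* x) (Z x) n')) n)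
            ≡⟨ Σrange-cong (suc j) k (λ ℓ _ → trans (cong (b ℓ *_) (shift-Σᶻ ℓ n (suc m) (λ x n' → shift (w N.* x) (Z x) n')))
                 (Σᶻ-scale (suc m) (b ℓ) (λ x → shift ℓ (λ n' → shift (w N.* x) (Z x) n') n))) ⟩
          Σrange (suc j) k (λ ℓ → Σᶻ (suc m) (λ x → b ℓ * shift ℓ (λ n' → shift (w N.* x) (Z x) n') n))
            ≡⟨ Σrange-Σᶻ (suc j) k (suc m) (λ x ℓ → b ℓ * shift ℓ (λ n' → shift (w N.* x) (Z x) n') n) ⟩
          Σᶻ (suc m) (λ x → Σrange (suc j) k (λ ℓ → b ℓ * shift ℓ (λ n' → shift (w N.* x) (Z x) n') n))
            ≡⟨ Σᶻ-cong (suc m) tail-slice ⟩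
          Σᶻ (suc m) V
            ≡⟨ cong₂ _+_ (trans (shift-by-0 w n _) (ZP.*-identityˡ _)) (Σᶻ-cong m V-suc) ⟩
          U' n (suc m) + Σᶻ m sliceTail ∎
          where
          V : ℕ → ℤ
          V x = shift (w N.* x) (λ n' → shift x (λ m' → co x m' * U' n' (suc m')) m) n
          V-suc : ∀ y → V (suc y) ≡ sliceTail y
          V-suc y = shift-cong (w N.* suc y) n (λ n' → trans
            (shift-cong (suc y) m (λ m' → cong (λ z → (+ (z C suc y) * β ^ suc y) * U' n' (suc m')) (sym (NP.+-suc y m'))))
            (shift-suc y m (λ m'' → (+ ((y N.+ m'') C suc y) * β ^ suc y) * U' n' m'')
              (trans (cong (λ z → (+ z * β ^ suc y) * U' n' 0)
                           (trans (cong (_C suc y) (NP.+-identityʳ y)) (k>n⇒nCk≡0 (NP.n<1+n y))))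
                     (ZP.*-zeroˡ (U' n' 0)))))

    -- Removing the first part of a composition: a composition of n into m+1
    -- parts of sizes in (j, j+k] is a part ℓ followed by one of n-ℓ into m parts.
    U-peel : ∀ j k n m → U b j k n (suc m) ≡ Σrange j k (λ ℓ → b ℓ * shift ℓ (λ n' → U b j k n' m) n)
    U-peel j zero n m = ZP.*-zeroʳ (δ 0 n)
    U-peel j (suc k) n m = begin
      slice 0 + Σᶻ (suc m) (λ y → slice (suc y))
        ≡⟨ cong₂ _+_ slice-0 (Σᶻ-cong (suc m) slice-pascal) ⟩
      U' n (suc m) + Σᶻ (suc m) (λ y → sliceHead y + sliceTail y)
        ≡⟨ cong (_+_ (U' n (suc m))) (Σᶻ-+ (suc m) sliceHead sliceTail) ⟩
      U' n (suc m) + (Σᶻ (suc m) sliceHead + Σᶻ (suc m) sliceTail)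
        ≡⟨ cong (λ z → U' n (suc m) + (Σᶻ (suc m) sliceHead + z))
                (trans (Σᶻ-snoc m sliceTail) (trans (cong (_+_ (Σᶻ m sliceTail)) sliceTail-last) (ZP.+-identityʳ _))) ⟩
      U' n (suc m) + (Σᶻ (suc m) sliceHead + Σᶻ m sliceTail)
        ≡⟨ rotate (U' n (suc m)) (Σᶻ (suc m) sliceHead) (Σᶻ m sliceTail) ⟩
      Σᶻ (suc m) sliceHead + (U' n (suc m) + Σᶻ m sliceTail)
        ≡⟨ cong₂ _+_ (sym Σ-sliceHead) (sym (Σ-sliceTail (U-peel (suc j) k))) ⟩
      β * shift w (λ n' → U b j (suc k) n' m) n + Σrange (suc j) k (λ ℓ → b ℓ * shift ℓ (λ n' → U b j (suc k) n' m) n) ∎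
      where
      open PeelStep j k n m
      rotate : ∀ u a c → u + (a + c) ≡ a + (u + c)
      rotate = solve-∀
    -- a composition of n has at most n parts
    U-vanish : ∀ j k m n → n < m → U b j k n m ≡ 0ℤ
    U-vanish j k (suc m) n (s≤s n≤m) = trans (U-peel j k n m) (Σrange-zero j k (λ ℓ j<ℓ →
      trans (cong (b ℓ *_) (shift-vanish ℓ n _ (λ n' eq → U-vanish j k m n' (lt ℓ n' j<ℓ eq))))
            (ZP.*-zeroʳ (b ℓ))))
      where
      lt : ∀ ℓ n' → j < ℓ → ℓ N.+ n' ≡ n → n' < m
      lt ℓ n' j<ℓ eq = NP.<-≤-trans (NP.<-≤-trans (NP.n<1+n n') (NP.+-monoˡ-≤ n' (NP.≤-trans (s≤s z≤n) j<ℓ)))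
                                    (NP.≤-trans (NP.≤-reflexive eq) n≤m)

    -- all compositions of n with parts of size at most K, any number of parts
    R : ℕ → ℕ → ℤ
    R K n = Σᶻ (suc n) (λ m → U b 0 K n m)

    R-0 : ∀ K → R K 0 ≡ 1ℤ
    R-0 K = trans (ZP.+-identityʳ _) (U-no-parts 0 K 0)

    R-suc : ∀ K n → R K (suc n) ≡ Σrange 0 K (λ ℓ → b ℓ * shift ℓ (R K) (suc n))
    R-suc K n = begin
      U b 0 K (suc n) 0 + Σᶻ (suc n) (λ m → U b 0 K (suc n) (suc m))
        ≡⟨ trans (cong (_+ Σᶻ (suc n) (λ m → U b 0 K (suc n) (suc m))) (U-no-parts 0 K (suc n))) (ZP.+-identityˡ _) ⟩
      Σᶻ (suc n) (λ m → U b 0 K (suc n) (suc m))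
        ≡⟨ Σᶻ-cong (suc n) (λ m → U-peel 0 K (suc n) m) ⟩
      Σᶻ (suc n) (λ m → Σrange 0 K (λ ℓ → b ℓ * shift ℓ (λ n' → U b 0 K n' m) (suc n)))
        ≡⟨ sym (Σrange-Σᶻ 0 K (suc n) (λ m ℓ → b ℓ * shift ℓ (λ n' → U b 0 K n' m) (suc n))) ⟩
      Σrange 0 K (λ ℓ → Σᶻ (suc n) (λ m → b ℓ * shift ℓ (λ n' → U b 0 K n' m) (suc n)))
        ≡⟨ Σrange-cong 0 K part ⟩
      Σrange 0 K (λ ℓ → b ℓ * shift ℓ (R K) (suc n)) ∎
      where
      lt : ∀ ℓ n' → 0 < ℓ → ℓ N.+ n' ≡ suc n → n' < suc n
      lt ℓ n' 0<ℓ eq = NP.<-≤-trans (NP.<-≤-trans (NP.n<1+n n') (NP.+-monoˡ-≤ n' 0<ℓ)) (NP.≤-reflexive eq)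
      part : ∀ ℓ → 0 < ℓ → Σᶻ (suc n) (λ m → b ℓ * shift ℓ (λ n' → U b 0 K n' m) (suc n)) ≡ b ℓ * shift ℓ (R K) (suc n)
      part ℓ 0<ℓ = begin
        Σᶻ (suc n) (λ m → b ℓ * shift ℓ (λ n' → U b 0 K n' m) (suc n))
          ≡⟨ sym (Σᶻ-scale (suc n) (b ℓ) (λ m → shift ℓ (λ n' → U b 0 K n' m) (suc n))) ⟩
        b ℓ * Σᶻ (suc n) (λ m → shift ℓ (λ n' → U b 0 K n' m) (suc n))
          ≡⟨ cong (b ℓ *_) (sym (shift-Σᶻ ℓ (suc n) (suc n) (λ m n' → U b 0 K n' m))) ⟩
        b ℓ * shift ℓ (λ n' → Σᶻ (suc n) (λ m → U b 0 K n' m)) (suc n)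
          ≡⟨ cong (b ℓ *_) (shift-cong≡ ℓ (suc n) (λ n' eq →
               Σᶻ-truncate n' (suc n) (U b 0 K n') (λ x n'<x → U-vanish 0 K x n' n'<x) (lt ℓ n' 0<ℓ eq))) ⟩
        b ℓ * shift ℓ (R K) (suc n) ∎

    R-indep : ∀ N K K' n → n ≤ N → n ≤ K → n ≤ K' → R K n ≡ R K' n
    R-indep N K K' zero _ _ _ = trans (R-0 K) (sym (R-0 K'))
    R-indep (suc N) K K' (suc n) (s≤s n≤N) nK nK' = begin
      R K (suc n)          ≡⟨ R-suc K n ⟩
      Σrange 0 K g         ≡⟨ Σrange-truncate K (suc n) g nK (beyond (R K)) ⟩
      Σrange 0 (suc n) g   ≡⟨ Σrange-cong 0 (suc n) (λ ℓ 0<ℓ → cong (b ℓ *_) (shift-cong≡ ℓ (suc n) (λ n' eq →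
                                 R-indep N K K' n' (NP.≤-trans (le ℓ n' 0<ℓ eq) n≤N)
                                   (NP.≤-trans (le ℓ n' 0<ℓ eq) (NP.≤-trans (NP.n≤1+n n) nK))
                                   (NP.≤-trans (le ℓ n' 0<ℓ eq) (NP.≤-trans (NP.n≤1+n n) nK'))))) ⟩
      Σrange 0 (suc n) g'  ≡⟨ sym (Σrange-truncate K' (suc n) g' nK' (beyond (R K'))) ⟩
      Σrange 0 K' g'       ≡⟨ sym (R-suc K' n) ⟩
      R K' (suc n) ∎
      where
      g g' : ℕ → ℤ
      g ℓ = b ℓ * shift ℓ (R K) (suc n)
      g' ℓ = b ℓ * shift ℓ (R K') (suc n)
      beyond : ∀ f ℓ → suc n < ℓ → b ℓ * shift ℓ f (suc n) ≡ 0ℤ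
      beyond f ℓ lt = trans (cong (b ℓ *_) (shift-below ℓ (suc n) f lt)) (ZP.*-zeroʳ (b ℓ))
      le : ∀ ℓ n' → 0 < ℓ → ℓ N.+ n' ≡ suc n → n' ≤ n
      le ℓ n' 0<ℓ eq = NP.≤-pred (NP.≤-trans (NP.+-monoˡ-≤ n' 0<ℓ) (NP.≤-reflexive eq))

    G : ℕ → ℤ
    G n = R n n

    G-suc : ∀ n → G (suc n) ≡ Σrange 0 (suc n) (λ ℓ → b ℓ * shift ℓ G (suc n))
    G-suc n = trans (R-suc (suc n) n) (Σrange-cong 0 (suc n) (λ ℓ 0<ℓ → cong (b ℓ *_)
      (shift-cong≡ ℓ (suc n) (λ n' eq → R-indep (suc n) (suc n) n' n' (le ℓ n' eq) (le ℓ n' eq) NP.≤-refl))))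
      where
      le : ∀ ℓ n' → ℓ N.+ n' ≡ suc n → n' ≤ suc n
      le ℓ n' eq = NP.≤-trans (NP.m≤n+m n' ℓ) (NP.≤-reflexive eq)


-- The sums Sum⁺ c d n and Sum± c d n of the theorem are instances of the
-- composition identity, with b_ℓ = T_{c+d(ℓ-1)} resp. b_ℓ = -T_{c+d(ℓ-1)}
-- (the sign (-1)^{σ s} is absorbed into the monomial).
module TupleSums where

  open FiniteSums
  open Compositions
  open import Data.Nat as N using (ℕ; zero; suc; _≤_; _<_; z≤n; s≤s; _≡ᵇ_; _!)
  import Data.Nat.Properties as NP
  open import Data.Nat.Combinatorics using (_C_; nCk≡n!/k![n-k]!; k![n∸k]!∣n!)
  open import Data.Nat.DivMod using (m/n*n≡m; m*n/n≡m; /-congˡ)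
  open import Data.Integer using (ℤ; +_; 0ℤ; 1ℤ; _+_; _*_; -_; _^_)
  import Data.Integer.Properties as ZP
  open import Data.Integer.Tactic.RingSolver using (solve-∀)
  open import Data.Vec as Vec using (Vec; []; _∷_)
  open import Data.List as List using (List; []; _∷_; _++_; concatMap; filterᵇ; applyUpTo)
  import Data.List.Properties as LP
  open import Data.Fin as Fin using (Fin; toℕ)
  open import Data.Bool using (Bool; true; false; if_then_else_)
  open import Relation.Nullary using (yes; no; ¬_)
  open import Relation.Binary.PropositionalEquality
  open ≡-Reasoning

  lsum : List ℤ → ℤ
  lsum = List.foldr _+_ 0ℤ

  lsum-++ : ∀ xs ys → lsum (xs ++ ys) ≡ lsum xs + lsum ys
  lsum-++ [] ys = sym (ZP.+-identityˡ _)
  lsum-++ (x ∷ xs) ys = trans (cong (_+_ x) (lsum-++ xs ys)) (sym (ZP.+-assoc x _ _))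

  module _ {A B : Set} where
    lsum-concatMap : ∀ (g : B → ℤ) (h : A → List B) xs →
      lsum (List.map g (concatMap h xs)) ≡ lsum (List.map (λ x → lsum (List.map g (h x))) xs)
    lsum-concatMap g h [] = refl
    lsum-concatMap g h (x ∷ xs) = begin
      lsum (List.map g (h x ++ concatMap h xs))
        ≡⟨ cong lsum (LP.map-++ g (h x) (concatMap h xs)) ⟩
      lsum (List.map g (h x) ++ List.map g (concatMap h xs))
        ≡⟨ lsum-++ (List.map g (h x)) _ ⟩
      lsum (List.map g (h x)) + lsum (List.map g (concatMap h xs))
        ≡⟨ cong (_+_ (lsum (List.map g (h x)))) (lsum-concatMap g h xs) ⟩
      lsum (List.map g (h x)) + lsum (List.map (λ x → lsum (List.map g (h x))) xs) ∎

  module _ {A : Set} where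
    lsum-filter : ∀ (g : A → ℤ) (P : A → Bool) xs →
      lsum (List.map g (filterᵇ P xs)) ≡ lsum (List.map (λ s → if P s then g s else 0ℤ) xs)
    lsum-filter g P [] = refl
    lsum-filter g P (x ∷ xs) with P x
    ... | true = cong (_+_ (g x)) (lsum-filter g P xs)
    ... | false = trans (lsum-filter g P xs) (sym (ZP.+-identityˡ _))

  lsum-upTo : ∀ (f : ℕ → ℤ) (h : ℕ → ℕ) n → lsum (List.map f (applyUpTo h n)) ≡ Σᶻ n (λ i → f (h i))
  lsum-upTo f h zero = refl
  lsum-upTo f h (suc n) = cong (_+_ (f (h 0))) (lsum-upTo f (λ i → h (suc i)) n)

  lsum-boxVecs : ∀ M k (g : Vec ℕ k → ℤ) → lsum (List.map g (boxVecs M k)) ≡ Σbox M k g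
  lsum-boxVecs M zero g = ZP.+-identityʳ (g [])
  lsum-boxVecs M (suc k) g = begin
    lsum (List.map g (concatMap (λ x → List.map (x ∷_) (boxVecs M k)) (List.upTo (suc M))))
      ≡⟨ lsum-concatMap g (λ x → List.map (x ∷_) (boxVecs M k)) (List.upTo (suc M)) ⟩
    lsum (List.map (λ x → lsum (List.map g (List.map (x ∷_) (boxVecs M k)))) (List.upTo (suc M)))
      ≡⟨ lsum-upTo (λ x → lsum (List.map g (List.map (x ∷_) (boxVecs M k)))) (λ i → i) (suc M) ⟩
    Σᶻ (suc M) (λ x → lsum (List.map g (List.map (x ∷_) (boxVecs M k))))
      ≡⟨ Σᶻ-cong (suc M) (λ x → trans (cong lsum (sym (LP.map-∘ {g = g} {f = x ∷_} (boxVecs M k))))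
                                      (lsum-boxVecs M k (λ v → g (x ∷ v)))) ⟩
    Σbox M (suc k) g ∎

  if-δ : ∀ a n X → (if a ≡ᵇ n then X else 0ℤ) ≡ δ a n * X
  if-δ zero zero X = sym (ZP.*-identityˡ X)
  if-δ zero (suc n) X = sym (ZP.*-zeroˡ X)
  if-δ (suc a) zero X = sym (ZP.*-zeroˡ X)
  if-δ (suc a) (suc n) X = if-δ a n X

  weight-from : ∀ {k} j (f : Fin k → ℕ) (s : Vec ℕ k) → (∀ i → f i ≡ suc (j N.+ toℕ i)) →
    Vec.sum (Vec.zipWith N._*_ (Vec.tabulate f) s) ≡ wt j s
  weight-from j f [] e = refl
  weight-from j f (x ∷ s) e = cong₂ N._+_ (cong (N._* x) (trans (e Fin.zero) (cong suc (NP.+-identityʳ j))))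
    (weight-from (suc j) (λ i → f (Fin.suc i)) s (λ i → trans (e (Fin.suc i)) (cong suc (NP.+-suc j (toℕ i)))))

  weight≡wt : ∀ {k} (s : Vec ℕ k) → weight s ≡ wt 0 s
  weight≡wt s = weight-from 0 _ s (λ i → refl)

  binomial-factorials : ∀ x s → ((x N.+ s) C x) N.* (x ! N.* s !) ≡ (x N.+ s) !
  binomial-factorials x s = begin
    ((x N.+ s) C x) N.* (x ! N.* s !)
      ≡⟨ cong (λ t → ((x N.+ s) C x) N.* (x ! N.* t !)) (sym (NP.m+n∸m≡n x s)) ⟩
    ((x N.+ s) C x) N.* (x ! N.* (x N.+ s N.∸ x) !)
      ≡⟨ cong (N._* (x ! N.* (x N.+ s N.∸ x) !)) (nCk≡n!/k![n-k]! (NP.m≤m+n x s)) ⟩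
    ((x N.+ s) ! N./ (x ! N.* (x N.+ s N.∸ x) !)) N.* (x ! N.* (x N.+ s N.∸ x) !)
      ≡⟨ m/n*n≡m (k![n∸k]!∣n! (NP.m≤m+n x s)) ⟩
    (x N.+ s) ! ∎
    where
    instance
      _ : N.NonZero (x ! N.* (x N.+ s N.∸ x) !)
      _ = NP.m*n≢0 (x !) ((x N.+ s N.∸ x) !) {{x NP.!≢0}} {{(x N.+ s N.∸ x) NP.!≢0}}

  multinom-factorials : ∀ {k} (v : Vec ℕ k) → multinom v N.* factProd v ≡ σ v !
  multinom-factorials [] = refl
  multinom-factorials (x ∷ v) = begin
    ((x N.+ σ v) C x) N.* multinom v N.* (x ! N.* factProd v)
      ≡⟨ regroup ((x N.+ σ v) C x) (multinom v) (x !) (factProd v) ⟩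
    ((x N.+ σ v) C x) N.* (x ! N.* (multinom v N.* factProd v))
      ≡⟨ cong (λ t → ((x N.+ σ v) C x) N.* (x ! N.* t)) (multinom-factorials v) ⟩
    ((x N.+ σ v) C x) N.* (x ! N.* σ v !)
      ≡⟨ binomial-factorials x (σ v) ⟩
    (x N.+ σ v) ! ∎
    where
    open import Data.Nat.Tactic.RingSolver using () renaming (solve-∀ to solveℕ)
    regroup : ∀ a b c d → a N.* b N.* (c N.* d) ≡ a N.* (c N.* (b N.* d))
    regroup = solveℕ

  p≡multinom : ∀ {k} (v : Vec ℕ k) → p v ≡ multinom v
  p≡multinom v = trans (/-congˡ {{factProd≢0 v}} (sym (multinom-factorials v)))
                       (m*n/n≡m (multinom v) (factProd v) {{factProd≢0 v}})

  tribPart : ℕ → ℕ → ℕ → ℤ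
  tribPart c d ℓ = + T (c N.+ d N.* (ℓ N.∸ 1))

  negTribPart : ℕ → ℕ → ℕ → ℤ
  negTribPart c d ℓ = - tribPart c d ℓ

  pos-^ : ∀ a x → + (a N.^ x) ≡ (+ a) ^ x
  pos-^ a zero = refl
  pos-^ a (suc x) = trans (ZP.pos-* a (a N.^ x)) (cong (_*_ (+ a)) (pos-^ a x))

  neg-^ : ∀ a x → (- a) ^ x ≡ sgn x * a ^ x
  neg-^ a zero = refl
  neg-^ a (suc x) = trans (cong (_*_ (- a)) (neg-^ a x)) (regroup a (sgn x) (a ^ x))
    where
    regroup : ∀ a s p → (- a) * (s * p) ≡ (- 1ℤ * s) * (a * p)
    regroup = solve-∀

  Tprod≡monomial : ∀ c d j {k} (s : Vec ℕ k) → + Tprod c d j s ≡ monomial (tribPart c d) j s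
  Tprod≡monomial c d j [] = refl
  Tprod≡monomial c d j (x ∷ s) = trans (ZP.pos-* (T (c N.+ d N.* j) N.^ x) (Tprod c d (suc j) s))
    (cong₂ _*_ (pos-^ (T (c N.+ d N.* j)) x) (Tprod≡monomial c d (suc j) s))

  signedTprod≡monomial : ∀ c d j {k} (s : Vec ℕ k) → sgn (σ s) * + Tprod c d j s ≡ monomial (negTribPart c d) j s
  signedTprod≡monomial c d j [] = refl
  signedTprod≡monomial c d j (x ∷ s) = begin
    sgn (x N.+ σ s) * + (t N.^ x N.* Tprod c d (suc j) s)
      ≡⟨ cong₂ _*_ (ZP.^-distribˡ-+-* (- 1ℤ) x (σ s)) (ZP.pos-* (t N.^ x) (Tprod c d (suc j) s)) ⟩
    (sgn x * sgn (σ s)) * (+ (t N.^ x) * + Tprod c d (suc j) s)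
      ≡⟨ cong (λ z → (sgn x * sgn (σ s)) * (z * + Tprod c d (suc j) s)) (pos-^ t x) ⟩
    (sgn x * sgn (σ s)) * ((+ t) ^ x * + Tprod c d (suc j) s)
      ≡⟨ transpose (sgn x) (sgn (σ s)) ((+ t) ^ x) (+ Tprod c d (suc j) s) ⟩
    (sgn x * (+ t) ^ x) * (sgn (σ s) * + Tprod c d (suc j) s)
      ≡⟨ cong₂ _*_ (sym (neg-^ (+ t) x)) (signedTprod≡monomial c d (suc j) s) ⟩
    monomial (negTribPart c d) j (x ∷ s) ∎
    where
    t = T (c N.+ d N.* j)
    transpose : ∀ a b e f → (a * b) * (e * f) ≡ (a * e) * (b * f)
    transpose = solve-∀

  σ≤wt : ∀ {k} j (v : Vec ℕ k) → σ v ≤ wt j v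
  σ≤wt j [] = z≤n
  σ≤wt j (x ∷ v) = NP.+-mono-≤ (NP.m≤m+n x (j N.* x)) (σ≤wt (suc j) v)

  δ-≢ : ∀ a n → ¬ a ≡ n → δ a n ≡ 0ℤ
  δ-≢ zero zero ne = ⊥-elim (ne refl)
    where open import Data.Empty using (⊥-elim)
  δ-≢ zero (suc n) ne = refl
  δ-≢ (suc a) zero ne = refl
  δ-≢ (suc a) (suc n) ne = δ-≢ a n (λ e → ne (cong suc e))

  -- a tuple of weight n has σ ≤ n, so we may split it by its number of parts
  split-by-parts : ∀ {k} (s : Vec ℕ k) n X →
    δ (wt 0 s) n * X ≡ Σᶻ (suc n) (λ m → δ (wt 0 s) n * (δ (σ s) m * X))
  split-by-parts s n X = trans main (Σᶻ-scale (suc n) (δ (wt 0 s) n) (λ m → δ (σ s) m * X))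
    where
    Σ-δX : ∀ a N → a < N → Σᶻ N (λ m → δ a m * X) ≡ X
    Σ-δX a N lt = begin
      Σᶻ N (λ m → δ a m * X)  ≡⟨ Σᶻ-cong N (λ m → ZP.*-comm (δ a m) X) ⟩
      Σᶻ N (λ m → X * δ a m)  ≡⟨ sym (Σᶻ-scale N X (δ a)) ⟩
      X * Σᶻ N (δ a)          ≡⟨ cong (X *_) (Σᶻ-δ a N lt) ⟩
      X * 1ℤ                  ≡⟨ ZP.*-identityʳ X ⟩
      X ∎
    main : δ (wt 0 s) n * X ≡ δ (wt 0 s) n * Σᶻ (suc n) (λ m → δ (σ s) m * X)
    main with wt 0 s N.≟ n
    ... | yes eq = cong (δ (wt 0 s) n *_) (sym (Σ-δX (σ s) (suc n) (s≤s (subst (σ s ≤_) eq (σ≤wt 0 s)))))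
    ... | no ne = trans (cong (_* X) (δ-≢ (wt 0 s) n ne)) (trans (ZP.*-zeroˡ X)
                  (sym (trans (cong (_* Σᶻ (suc n) (λ m → δ (σ s) m * X)) (δ-≢ (wt 0 s) n ne))
                              (ZP.*-zeroˡ (Σᶻ (suc n) (λ m → δ (σ s) m * X))))))

  Σbox-weight≡G : ∀ (b : ℕ → ℤ) n → Σbox n n (λ s → δ (wt 0 s) n * term b 0 s) ≡ G b n
  Σbox-weight≡G b n = begin
    Σbox n n (λ s → δ (wt 0 s) n * term b 0 s)
      ≡⟨ Σbox-cong n n (λ s → split-by-parts s n (term b 0 s)) ⟩
    Σbox n n (λ s → Σᶻ (suc n) (λ m → δ (wt 0 s) n * (δ (σ s) m * term b 0 s)))
      ≡⟨ Σbox-Σᶻ n n (suc n) (λ m s → δ (wt 0 s) n * (δ (σ s) m * term b 0 s)) ⟩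
    Σᶻ (suc n) (λ m → Ubox b 0 n n n m)
      ≡⟨ Σᶻ-cong< (suc n) (λ m m<sn → Ubox≡U b 0 n n n m (NP.≤-pred m<sn)) ⟩
    G b n ∎

  tupleSum≡G : ∀ (b : ℕ → ℤ) n (g : Vec ℕ n → ℤ) → (∀ s → g s ≡ + p s * monomial b 0 s) →
    lsum (List.map g (tuples n)) ≡ G b n
  tupleSum≡G b n g eq = begin
    lsum (List.map g (filterᵇ (λ s → weight s ≡ᵇ n) (boxVecs n n)))
      ≡⟨ lsum-filter g (λ s → weight s ≡ᵇ n) (boxVecs n n) ⟩
    lsum (List.map (λ s → if weight s ≡ᵇ n then g s else 0ℤ) (boxVecs n n))
      ≡⟨ lsum-boxVecs n n (λ s → if weight s ≡ᵇ n then g s else 0ℤ) ⟩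
    Σbox n n (λ s → if weight s ≡ᵇ n then g s else 0ℤ)
      ≡⟨ Σbox-cong n n (λ s → trans (if-δ (weight s) n (g s))
           (cong₂ (λ a z → δ a n * z) (weight≡wt s)
                  (trans (eq s) (cong (λ z → + z * monomial b 0 s) (p≡multinom s))))) ⟩
    Σbox n n (λ s → δ (wt 0 s) n * term b 0 s)
      ≡⟨ Σbox-weight≡G b n ⟩
    G b n ∎

  Sum⁺≡G : ∀ c d n → Sum⁺ c d n ≡ G (tribPart c d) n
  Sum⁺≡G c d n = tupleSum≡G (tribPart c d) n _ (λ s →
    trans (ZP.pos-* (p s) (Tprod c d 0 s)) (cong (+ p s *_) (Tprod≡monomial c d 0 s)))

  Sum±≡G : ∀ c d n → Sum± c d n ≡ G (negTribPart c d) n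
  Sum±≡G c d n = tupleSum≡G (negTribPart c d) n _ (λ s → begin
    sgn (σ s) * + (p s N.* Tprod c d 0 s)      ≡⟨ cong (sgn (σ s) *_) (ZP.pos-* (p s) (Tprod c d 0 s)) ⟩
    sgn (σ s) * (+ p s * + Tprod c d 0 s)      ≡⟨ swap (sgn (σ s)) (+ p s) (+ Tprod c d 0 s) ⟩
    + p s * (sgn (σ s) * + Tprod c d 0 s)      ≡⟨ cong (+ p s *_) (signedTprod≡monomial c d 0 s) ⟩
    + p s * monomial (negTribPart c d) 0 s ∎)
    where
    swap : ∀ a b e → a * (b * e) ≡ b * (a * e)
    swap = solve-∀


-- If the parts b_ℓ (ℓ ≥ 1) satisfy a linear recurrence of order three, then so
-- does G b (from index 1 on): on generating functions, 1/(1 - B(x)) with B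
-- rational of denominator of degree three.  Combined with uniqueness of
-- solutions of such recurrences, every item reduces to checking initial values.
module Recurrences where

  open FiniteSums
  open Compositions
  open TupleSums
  open import Data.Nat as N using (ℕ; zero; suc; _<_)
  open import Data.Integer using (ℤ; +_; _+_; _*_; -_; _-_)
  import Data.Integer.Properties as ZP
  open import Data.Integer.Tactic.RingSolver using (solve-∀)
  import Data.Nat.Tactic.RingSolver as ℕ-Solver
  open import Data.Product using (_×_; _,_; proj₁)
  open import Relation.Binary.PropositionalEquality
  open ≡-Reasoning

  conv : (ℕ → ℤ) → (ℕ → ℤ) → ℕ → ℤ
  conv b H n = Σrange 0 n (λ ℓ → b ℓ * shift ℓ H n)

  conv-suc : ∀ b H n → conv b H (suc n) ≡ b 1 * H n + conv (λ ℓ → b (suc ℓ)) H n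
  conv-suc b H n = cong (_+_ (b 1 * H n)) (Σrange-suc 0 n (λ ℓ → b ℓ * shift ℓ H (suc n)))

  conv-linear : ∀ (f₃ f₂ f₁ f₀ : ℕ → ℤ) α β γ H n → (∀ ℓ → 0 < ℓ → f₃ ℓ ≡ α * f₂ ℓ + β * f₁ ℓ + γ * f₀ ℓ) →
    conv f₃ H n ≡ α * conv f₂ H n + β * conv f₁ H n + γ * conv f₀ H n
  conv-linear f₃ f₂ f₁ f₀ α β γ H n e = begin
    Σrange 0 n (λ ℓ → f₃ ℓ * shift ℓ H n)
      ≡⟨ Σrange-cong 0 n (λ ℓ lt → trans (cong (_* shift ℓ H n) (e ℓ lt)) (distrib α β γ (f₂ ℓ) (f₁ ℓ) (f₀ ℓ) (shift ℓ H n))) ⟩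
    Σrange 0 n (λ ℓ → α * (f₂ ℓ * shift ℓ H n) + β * (f₁ ℓ * shift ℓ H n) + γ * (f₀ ℓ * shift ℓ H n))
      ≡⟨ trans (Σrange-+ 0 n _ _) (cong₂ _+_ (Σrange-+ 0 n _ _) refl) ⟩
    Σrange 0 n (λ ℓ → α * (f₂ ℓ * shift ℓ H n)) + Σrange 0 n (λ ℓ → β * (f₁ ℓ * shift ℓ H n))
      + Σrange 0 n (λ ℓ → γ * (f₀ ℓ * shift ℓ H n))
      ≡⟨ cong₂ _+_ (cong₂ _+_ (sym (Σrange-scale 0 n α _)) (sym (Σrange-scale 0 n β _))) (sym (Σrange-scale 0 n γ _)) ⟩
    α * conv f₂ H n + β * conv f₁ H n + γ * conv f₀ H n ∎
    where
    distrib : ∀ α β γ x y z s → (α * x + β * y + γ * z) * s ≡ α * (x * s) + β * (y * s) + γ * (z * s)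
    distrib = solve-∀

  eliminate : ∀ G₂ G₁ G₀ X₂ X₁ X₀ b₁ b₂ b₃ α β γ →
    G₂ ≡ b₁ * G₁ + (b₂ * G₀ + X₂) → G₁ ≡ b₁ * G₀ + X₁ → G₀ ≡ X₀ →
    b₁ * G₂ + (b₂ * G₁ + (b₃ * G₀ + (α * X₂ + β * X₁ + γ * X₀)))
    ≡ (α + b₁) * G₂ + (β + b₂ - α * b₁) * G₁ + (γ + b₃ - α * b₂ - β * b₁) * G₀
  eliminate _ _ _ X₂ X₁ X₀ b₁ b₂ b₃ α β γ refl refl refl = identity X₂ X₁ X₀ b₁ b₂ b₃ α β γ
    where
    identity : ∀ X₂ X₁ X₀ b₁ b₂ b₃ α β γ →
      b₁ * (b₁ * (b₁ * X₀ + X₁) + (b₂ * X₀ + X₂)) + (b₂ * (b₁ * X₀ + X₁) + (b₃ * X₀ + (α * X₂ + β * X₁ + γ * X₀)))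
      ≡ (α + b₁) * (b₁ * (b₁ * X₀ + X₁) + (b₂ * X₀ + X₂)) + (β + b₂ - α * b₁) * (b₁ * X₀ + X₁)
        + (γ + b₃ - α * b₂ - β * b₁) * X₀
    identity = solve-∀

  module G-Recurrence (b : ℕ → ℤ) (α β γ : ℤ)
    (b-rec : ∀ ℓ → 0 < ℓ → b (3 N.+ ℓ) ≡ α * b (2 N.+ ℓ) + β * b (1 N.+ ℓ) + γ * b ℓ) where
    private
      g = G b
      c₁ c₂ c₃ : ℕ → ℤ
      c₁ ℓ = b (suc ℓ)
      c₂ ℓ = b (suc (suc ℓ))
      c₃ ℓ = b (suc (suc (suc ℓ)))

    G-rec : ∀ n → g (4 N.+ n) ≡ (α + b 1) * g (3 N.+ n) + (β + b 2 - α * b 1) * g (2 N.+ n)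
                                 + (γ + b 3 - α * b 2 - β * b 1) * g (1 N.+ n)
    G-rec n = begin
      g (4 N.+ n)  ≡⟨ G-suc b (3 N.+ n) ⟩
      conv b g (4 N.+ n)  ≡⟨ conv-suc b g (3 N.+ n) ⟩
      b 1 * g (3 N.+ n) + conv c₁ g (3 N.+ n)
        ≡⟨ cong (_+_ (b 1 * g (3 N.+ n))) (conv-suc c₁ g (2 N.+ n)) ⟩
      b 1 * g (3 N.+ n) + (b 2 * g (2 N.+ n) + conv c₂ g (2 N.+ n))
        ≡⟨ cong (λ z → b 1 * g (3 N.+ n) + (b 2 * g (2 N.+ n) + z)) (conv-suc c₂ g (1 N.+ n)) ⟩
      b 1 * g (3 N.+ n) + (b 2 * g (2 N.+ n) + (b 3 * g (1 N.+ n) + conv c₃ g (1 N.+ n)))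
        ≡⟨ cong (λ z → b 1 * g (3 N.+ n) + (b 2 * g (2 N.+ n) + (b 3 * g (1 N.+ n) + z)))
                (conv-linear c₃ c₂ c₁ b α β γ g (1 N.+ n) b-rec) ⟩
      b 1 * g (3 N.+ n) + (b 2 * g (2 N.+ n) + (b 3 * g (1 N.+ n)
        + (α * conv c₂ g (1 N.+ n) + β * conv c₁ g (1 N.+ n) + γ * conv b g (1 N.+ n))))
        ≡⟨ eliminate (g (3 N.+ n)) (g (2 N.+ n)) (g (1 N.+ n)) (conv c₂ g (1 N.+ n)) (conv c₁ g (1 N.+ n))
             (conv b g (1 N.+ n)) (b 1) (b 2) (b 3) α β γ
             (trans (G-suc b (2 N.+ n)) (trans (conv-suc b g (2 N.+ n)) (cong (_+_ (b 1 * g (2 N.+ n))) (conv-suc c₁ g (1 N.+ n)))))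
             (trans (G-suc b (1 N.+ n)) (conv-suc b g (1 N.+ n)))
             (G-suc b n) ⟩
      (α + b 1) * g (3 N.+ n) + (β + b 2 - α * b 1) * g (2 N.+ n) + (γ + b 3 - α * b 2 - β * b 1) * g (1 N.+ n) ∎

  recurrence-unique : ∀ (A B : ℕ → ℤ) c₂ c₁ c₀ →
    (∀ n → A (3 N.+ n) ≡ c₂ * A (2 N.+ n) + c₁ * A (1 N.+ n) + c₀ * A n) →
    (∀ n → B (3 N.+ n) ≡ c₂ * B (2 N.+ n) + c₁ * B (1 N.+ n) + c₀ * B n) →
    A 0 ≡ B 0 → A 1 ≡ B 1 → A 2 ≡ B 2 → ∀ n → A n ≡ B n
  recurrence-unique A B c₂ c₁ c₀ ra rb e₀ e₁ e₂ n = proj₁ (window n)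
    where
    Agree3 : ℕ → Set
    Agree3 n = (A n ≡ B n) × (A (1 N.+ n) ≡ B (1 N.+ n)) × (A (2 N.+ n) ≡ B (2 N.+ n))
    window : ∀ n → Agree3 n
    window zero = e₀ , e₁ , e₂
    window (suc n) with window n
    ... | x , y , z = y , z , trans (ra n) (trans (cong₂ _+_ (cong₂ _+_ (cong (c₂ *_) z) (cong (c₁ *_) y)) (cong (c₀ *_) x))
                                                 (sym (rb n)))

  T-step2 : ∀ x → T (6 N.+ x) ≡ 3 N.* T (4 N.+ x) N.+ T (2 N.+ x) N.+ T x
  T-step2 x = unfold (T x) (T (1 N.+ x)) (T (2 N.+ x)) _ _ _ refl refl refl
    where
    identity : ∀ t₀ t₁ t₂ → let t₃ = t₂ N.+ t₁ N.+ t₀ ; t₄ = t₃ N.+ t₂ N.+ t₁ ; t₅ = t₄ N.+ t₃ N.+ t₂ in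
               t₅ N.+ t₄ N.+ t₃ ≡ 3 N.* t₄ N.+ t₂ N.+ t₀
    identity = ℕ-Solver.solve-∀
    unfold : ∀ t₀ t₁ t₂ t₃ t₄ t₅ → t₃ ≡ t₂ N.+ t₁ N.+ t₀ → t₄ ≡ t₃ N.+ t₂ N.+ t₁ → t₅ ≡ t₄ N.+ t₃ N.+ t₂ →
             t₅ N.+ t₄ N.+ t₃ ≡ 3 N.* t₄ N.+ t₂ N.+ t₀
    unfold t₀ t₁ t₂ _ _ _ refl refl refl = identity t₀ t₁ t₂

  pos-combination : ∀ a b c d α β γ → a ≡ α N.* b N.+ β N.* c N.+ γ N.* d →
    + a ≡ + α * + b + + β * + c + + γ * + d
  pos-combination a b c d α β γ e = trans (cong +_ e) (trans (ZP.pos-+ (α N.* b N.+ β N.* c) (γ N.* d))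
    (cong₂ _+_ (trans (ZP.pos-+ (α N.* b) (β N.* c)) (cong₂ _+_ (ZP.pos-* α b) (ZP.pos-* β c))) (ZP.pos-* γ d)))

  tribPart₁-rec : ∀ c ℓ → 0 < ℓ → tribPart c 1 (3 N.+ ℓ) ≡ + 1 * tribPart c 1 (2 N.+ ℓ) + + 1 * tribPart c 1 (1 N.+ ℓ) + + 1 * tribPart c 1 ℓ
  tribPart₁-rec c (suc ℓ) _ =
    pos-combination (T (c N.+ 1 N.* (3 N.+ ℓ))) (T (c N.+ 1 N.* (2 N.+ ℓ))) (T (c N.+ 1 N.* (1 N.+ ℓ))) (T (c N.+ 1 N.* ℓ)) 1 1 1 (begin
    T (c N.+ 1 N.* (3 N.+ ℓ))  ≡⟨ cong T (index c 3 ℓ) ⟩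
    T (3 N.+ (c N.+ ℓ))        ≡⟨ units (T (2 N.+ (c N.+ ℓ))) (T (1 N.+ (c N.+ ℓ))) (T (c N.+ ℓ)) ⟩
    1 N.* T (2 N.+ (c N.+ ℓ)) N.+ 1 N.* T (1 N.+ (c N.+ ℓ)) N.+ 1 N.* T (c N.+ ℓ)
      ≡⟨ sym (cong₂ N._+_ (cong₂ N._+_ (cong (λ z → 1 N.* T z) (index c 2 ℓ)) (cong (λ z → 1 N.* T z) (index c 1 ℓ)))
                          (cong (λ z → 1 N.* T z) (index c 0 ℓ))) ⟩
    1 N.* T (c N.+ 1 N.* (2 N.+ ℓ)) N.+ 1 N.* T (c N.+ 1 N.* (1 N.+ ℓ)) N.+ 1 N.* T (c N.+ 1 N.* ℓ) ∎)
    where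
    index : ∀ c k ℓ → c N.+ 1 N.* (k N.+ ℓ) ≡ k N.+ (c N.+ ℓ)
    index = ℕ-Solver.solve-∀
    units : ∀ a b d → a N.+ b N.+ d ≡ 1 N.* a N.+ 1 N.* b N.+ 1 N.* d
    units = ℕ-Solver.solve-∀

  tribPart₂-rec : ∀ c ℓ → 0 < ℓ → tribPart c 2 (3 N.+ ℓ) ≡ + 3 * tribPart c 2 (2 N.+ ℓ) + + 1 * tribPart c 2 (1 N.+ ℓ) + + 1 * tribPart c 2 ℓ
  tribPart₂-rec c (suc ℓ) _ =
    pos-combination (T (c N.+ 2 N.* (3 N.+ ℓ))) (T (c N.+ 2 N.* (2 N.+ ℓ))) (T (c N.+ 2 N.* (1 N.+ ℓ))) (T (c N.+ 2 N.* ℓ)) 3 1 1 (begin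
    T (c N.+ 2 N.* (3 N.+ ℓ))  ≡⟨ cong T (index c 3 ℓ) ⟩
    T (6 N.+ (c N.+ 2 N.* ℓ))  ≡⟨ T-step2 (c N.+ 2 N.* ℓ) ⟩
    3 N.* T (4 N.+ (c N.+ 2 N.* ℓ)) N.+ T (2 N.+ (c N.+ 2 N.* ℓ)) N.+ T (c N.+ 2 N.* ℓ)
      ≡⟨ units (3 N.* T (4 N.+ (c N.+ 2 N.* ℓ))) (T (2 N.+ (c N.+ 2 N.* ℓ))) (T (c N.+ 2 N.* ℓ)) ⟩
    3 N.* T (4 N.+ (c N.+ 2 N.* ℓ)) N.+ 1 N.* T (2 N.+ (c N.+ 2 N.* ℓ)) N.+ 1 N.* T (c N.+ 2 N.* ℓ)
      ≡⟨ sym (cong₂ N._+_ (cong₂ N._+_ (cong (λ z → 3 N.* T z) (index c 2 ℓ)) (cong (λ z → 1 N.* T z) (index c 1 ℓ)))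
                          (cong (λ z → 1 N.* T z) (index c 0 ℓ))) ⟩
    3 N.* T (c N.+ 2 N.* (2 N.+ ℓ)) N.+ 1 N.* T (c N.+ 2 N.* (1 N.+ ℓ)) N.+ 1 N.* T (c N.+ 2 N.* ℓ) ∎)
    where
    index : ∀ c k ℓ → c N.+ 2 N.* (k N.+ ℓ) ≡ (2 N.* k) N.+ (c N.+ 2 N.* ℓ)
    index = ℕ-Solver.solve-∀
    units : ∀ a b d → a N.+ b N.+ d ≡ a N.+ 1 N.* b N.+ 1 N.* d
    units = ℕ-Solver.solve-∀

  negate-rec : ∀ (b : ℕ → ℤ) α β γ → (∀ ℓ → 0 < ℓ → b (3 N.+ ℓ) ≡ α * b (2 N.+ ℓ) + β * b (1 N.+ ℓ) + γ * b ℓ) →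
    ∀ ℓ → 0 < ℓ → - b (3 N.+ ℓ) ≡ α * - b (2 N.+ ℓ) + β * - b (1 N.+ ℓ) + γ * - b ℓ
  negate-rec b α β γ e ℓ lt = trans (cong -_ (e ℓ lt)) (distrib α β γ (b (2 N.+ ℓ)) (b (1 N.+ ℓ)) (b ℓ))
    where
    distrib : ∀ α β γ x y z → - (α * x + β * y + γ * z) ≡ α * - x + β * - y + γ * - z
    distrib = solve-∀

  module Transport (A : ℕ → ℤ) (b : ℕ → ℤ) (A≡G : ∀ n → A n ≡ G b n) (α β γ : ℤ)
    (b-rec : ∀ ℓ → 0 < ℓ → b (3 N.+ ℓ) ≡ α * b (2 N.+ ℓ) + β * b (1 N.+ ℓ) + γ * b ℓ) where

    rec : ∀ n → A (4 N.+ n) ≡ (α + b 1) * A (3 N.+ n) + (β + b 2 - α * b 1) * A (2 N.+ n)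
                               + (γ + b 3 - α * b 2 - β * b 1) * A (1 N.+ n)
    rec n = trans (A≡G (4 N.+ n)) (trans (G-Recurrence.G-rec b α β γ b-rec n)
      (sym (cong₂ _+_ (cong₂ _+_ (cong ((α + b 1) *_) (A≡G (3 N.+ n))) (cong ((β + b 2 - α * b 1) *_) (A≡G (2 N.+ n))))
                       (cong ((γ + b 3 - α * b 2 - β * b 1) *_) (A≡G (1 N.+ n))))))

  module Sum⁺₁ (c : ℕ) = Transport (Sum⁺ c 1) (tribPart c 1) (Sum⁺≡G c 1) (+ 1) (+ 1) (+ 1) (tribPart₁-rec c)
  module Sum⁺₂ (c : ℕ) = Transport (Sum⁺ c 2) (tribPart c 2) (Sum⁺≡G c 2) (+ 3) (+ 1) (+ 1) (tribPart₂-rec c)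
  module Sum±₁ (c : ℕ) = Transport (Sum± c 1) (negTribPart c 1) (Sum±≡G c 1) (+ 1) (+ 1) (+ 1)
                                   (negate-rec (tribPart c 1) (+ 1) (+ 1) (+ 1) (tribPart₁-rec c))
  module Sum±₂ (c : ℕ) = Transport (Sum± c 2) (negTribPart c 2) (Sum±≡G c 2) (+ 3) (+ 1) (+ 1)
                                   (negate-rec (tribPart c 2) (+ 3) (+ 1) (+ 1) (tribPart₂-rec c))


module Division where

  open import Data.Nat using (_+_; _*_; _/_; _<_; NonZero)
  open import Data.Nat.DivMod using (+-distrib-/-∣ʳ; m<n⇒m/n≡0; m*n/n≡m; m≡m%n+[m/n]*n; m%n<n)
  open import Data.Nat.Divisibility using (n∣m*n)
  import Data.Nat.Properties as NP
  open import Relation.Binary.PropositionalEquality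

  quotient : ∀ d .{{_ : NonZero d}} a r → r < d → (r + a * d) / d ≡ a
  quotient d a r r<d = trans (+-distrib-/-∣ʳ r (n∣m*n a)) (cong₂ _+_ (m<n⇒m/n≡0 r<d) (m*n/n≡m a d))

  below-next-multiple : ∀ d .{{_ : NonZero d}} m → m < d * (m / d + 1)
  below-next-multiple d m = subst (m <_) (regroup (m / d))
    (subst (_< d + (m / d) * d) (sym (m≡m%n+[m/n]*n m d)) (NP.+-monoˡ-< ((m / d) * d) (m%n<n m d)))
    where
    regroup : ∀ q → d + q * d ≡ d * (q + 1)
    regroup q = trans (NP.+-comm d (q * d)) (trans (cong (q * d +_) (sym (NP.*-identityʳ d)))
                  (trans (cong (_+ d * 1) (NP.*-comm q d)) (sym (NP.*-distribˡ-+ d q 1))))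


-- Items with a closed form: each sum satisfies the recurrence of its family
-- (with the coefficients below, computed from T_c, T_{c+d}, T_{c+2d}), and so
-- does the claimed closed form; uniqueness then needs three initial values.
module ClosedForms where

  open Recurrences using (recurrence-unique; module Sum±₁; module Sum±₂)
  open import Data.Nat as N using (ℕ; zero; suc; _≥_; _%_; _/_)
  import Data.Nat.Properties as NP
  import Data.Nat.DivMod as ND
  open import Data.Integer using (ℤ; +_; 0ℤ; _+_; _*_; -_)
  import Data.Integer.Properties as ZP
  open import Data.Integer.Tactic.RingSolver using (solve-∀)
  import Data.Nat.Tactic.RingSolver as ℕ-Solver
  open import Data.Product using (_×_; _,_)
  open import Relation.Binary.PropositionalEquality

  from : ∀ k (Q : ℕ → Set) → (∀ m → Q (k N.+ m)) → ∀ n → n ≥ k → Q n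
  from k Q h n le = subst Q (NP.m+[n∸m]≡n le) (h (n N.∸ k))

  -1ℤ : ℤ
  -1ℤ = - (+ 1)

  rec8 : ∀ n → Sum± 3 1 (4 N.+ n) ≡ 0ℤ * Sum± 3 1 (3 N.+ n) + 0ℤ * Sum± 3 1 (2 N.+ n) + 0ℤ * Sum± 3 1 (1 N.+ n)
  rec8 = Sum±₁.rec 3

  item8 : ∀ n → n ≥ 4 → Sum± 3 1 n ≡ + 0
  item8 = from 4 (λ n → Sum± 3 1 n ≡ + 0) (λ m →
    trans (rec8 m) (annihilate (Sum± 3 1 (3 N.+ m)) (Sum± 3 1 (2 N.+ m)) (Sum± 3 1 (1 N.+ m))))
    where
    annihilate : ∀ a b c → 0ℤ * a + 0ℤ * b + 0ℤ * c ≡ 0ℤ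
    annihilate = solve-∀

  rec11 : ∀ n → Sum± 4 2 (4 N.+ n) ≡ + 1 * Sum± 4 2 (3 N.+ n) + 0ℤ * Sum± 4 2 (2 N.+ n) + 0ℤ * Sum± 4 2 (1 N.+ n)
  rec11 = Sum±₂.rec 4

  item11 : ∀ n → n ≥ 3 → Sum± 4 2 n ≡ - (+ 4)
  item11 = from 3 (λ n → Sum± 4 2 n ≡ - (+ 4)) constant
    where
    first : ∀ a b c → + 1 * a + 0ℤ * b + 0ℤ * c ≡ a
    first = solve-∀
    constant : ∀ m → Sum± 4 2 (3 N.+ m) ≡ - (+ 4)
    constant zero = refl
    constant (suc m) = trans (rec11 m) (trans (first (Sum± 4 2 (3 N.+ m)) (Sum± 4 2 (2 N.+ m)) (Sum± 4 2 (1 N.+ m)))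
                                              (constant m))

  rec13 : ∀ n → Sum± 5 2 (4 N.+ n) ≡ -1ℤ * Sum± 5 2 (3 N.+ n) + 0ℤ * Sum± 5 2 (2 N.+ n) + 0ℤ * Sum± 5 2 (1 N.+ n)
  rec13 = Sum±₂.rec 5

  item13 : ∀ n → n ≥ 3 → Sum± 5 2 n ≡ + 4 * sgn n
  item13 = from 3 (λ n → Sum± 5 2 n ≡ + 4 * sgn n) alternating
    where
    flip : ∀ b c s → -1ℤ * (+ 4 * s) + 0ℤ * b + 0ℤ * c ≡ + 4 * (-1ℤ * s)
    flip = solve-∀
    alternating : ∀ m → Sum± 5 2 (3 N.+ m) ≡ + 4 * sgn (3 N.+ m)
    alternating zero = refl
    alternating (suc m) = trans (rec13 m)
      (trans (cong (λ a → -1ℤ * a + 0ℤ * Sum± 5 2 (2 N.+ m) + 0ℤ * Sum± 5 2 (1 N.+ m)) (alternating m))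
             (flip (Sum± 5 2 (2 N.+ m)) (Sum± 5 2 (1 N.+ m)) (sgn (3 N.+ m))))

  -- Item 6.  Sum± 1 2 (n+4) = 3 · Sum± 1 2 (n+3), so Sum± 1 2 (m+3) = -4·3^m,
  -- which is -⌊4·3^{m+3}/27⌋.
  rec6 : ∀ n → Sum± 1 2 (4 N.+ n) ≡ + 3 * Sum± 1 2 (3 N.+ n) + 0ℤ * Sum± 1 2 (2 N.+ n) + 0ℤ * Sum± 1 2 (1 N.+ n)
  rec6 = Sum±₂.rec 1

  item6 : ∀ n → n ≥ 1 → Sum± 1 2 n ≡ - (+ ((4 N.* 3 N.^ n) / 27))
  item6 (suc zero) _ = refl
  item6 (suc (suc zero)) _ = refl
  item6 (suc (suc (suc m))) _ = trans (geometric m) (cong (λ z → - (+ z)) (sym exact))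
    where
    triple : ∀ x b c → + 3 * - x + 0ℤ * b + 0ℤ * c ≡ - (+ 3 * x)
    triple = solve-∀
    commute : ∀ t → 3 N.* (4 N.* t) ≡ 4 N.* (3 N.* t)
    commute = ℕ-Solver.solve-∀
    geometric : ∀ m → Sum± 1 2 (3 N.+ m) ≡ - (+ (4 N.* 3 N.^ m))
    geometric zero = refl
    geometric (suc m) = trans (rec6 m)
      (trans (cong (λ z → + 3 * z + 0ℤ * Sum± 1 2 (2 N.+ m) + 0ℤ * Sum± 1 2 (1 N.+ m)) (geometric m))
      (trans (triple (+ (4 N.* 3 N.^ m)) (Sum± 1 2 (2 N.+ m)) (Sum± 1 2 (1 N.+ m)))
             (cong -_ (trans (sym (ZP.pos-* 3 (4 N.* 3 N.^ m))) (cong +_ (commute (3 N.^ m)))))))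
    power : ∀ t → 4 N.* (3 N.* (3 N.* (3 N.* t))) ≡ 4 N.* t N.* 27
    power = ℕ-Solver.solve-∀
    exact : (4 N.* 3 N.^ (3 N.+ m)) / 27 ≡ 4 N.* 3 N.^ m
    exact = trans (cong (_/ 27) (power (3 N.^ m))) (ND.m*n/n≡m (4 N.* 3 N.^ m) 27)

  rec7 : ∀ n → Sum± 2 1 (4 N.+ n) ≡ 0ℤ * Sum± 2 1 (3 N.+ n) + + 1 * Sum± 2 1 (2 N.+ n) + + 1 * Sum± 2 1 (1 N.+ n)
  rec7 = Sum±₁.rec 2

  item7 : ∀ n → n ≥ 1 → Sum± 2 1 n ≡ - (+ P (n N.+ 2))
  item7 (suc m) _ = trans (agree m) (cong (λ z → - (+ P (suc z))) (NP.+-comm 2 m))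
    where
    padovan : ℕ → ℤ
    padovan m = - (+ P (3 N.+ m))
    padovan-rec : ∀ m → padovan (3 N.+ m) ≡ 0ℤ * padovan (2 N.+ m) + + 1 * padovan (1 N.+ m) + + 1 * padovan m
    padovan-rec m = trans (cong -_ (ZP.pos-+ (P (4 N.+ m)) (P (3 N.+ m)))) (distrib (+ P (4 N.+ m)) (+ P (3 N.+ m)) (padovan (2 N.+ m)))
      where
      distrib : ∀ x y z → - (x + y) ≡ 0ℤ * z + + 1 * - x + + 1 * - y
      distrib = solve-∀
    agree : ∀ m → Sum± 2 1 (1 N.+ m) ≡ padovan m
    agree = recurrence-unique (λ m → Sum± 2 1 (1 N.+ m)) padovan 0ℤ (+ 1) (+ 1) rec7 padovan-rec refl refl refl

  rec1 : ∀ n → Sum± 0 1 (4 N.+ n) ≡ + 1 * Sum± 0 1 (3 N.+ n) + + 1 * Sum± 0 1 (2 N.+ n) + 0ℤ * Sum± 0 1 (1 N.+ n)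
  rec1 = Sum±₁.rec 0

  item1 : ∀ n → n ≥ 2 → Sum± 0 1 n ≡ - (+ F (n N.∸ 2))
  item1 (suc m) _ = agree m
    where
    fibonacci : ℕ → ℤ
    fibonacci m = - (+ F (m N.∸ 1))
    fibonacci-rec : ∀ m → fibonacci (3 N.+ m) ≡ + 1 * fibonacci (2 N.+ m) + + 1 * fibonacci (1 N.+ m) + 0ℤ * fibonacci m
    fibonacci-rec m = trans (cong -_ (ZP.pos-+ (F (1 N.+ m)) (F m))) (distrib (+ F (1 N.+ m)) (+ F m) (fibonacci m))
      where
      distrib : ∀ x y z → - (x + y) ≡ + 1 * - x + + 1 * - y + 0ℤ * z
      distrib = solve-∀
    agree : ∀ m → Sum± 0 1 (1 N.+ m) ≡ fibonacci m
    agree = recurrence-unique (λ m → Sum± 0 1 (1 N.+ m)) fibonacci (+ 1) (+ 1) 0ℤ rec1 fibonacci-rec refl refl refl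

  rec10 : ∀ n → Sum± 4 1 (4 N.+ n) ≡ -1ℤ * Sum± 4 1 (3 N.+ n) + -1ℤ * Sum± 4 1 (2 N.+ n) + 0ℤ * Sum± 4 1 (1 N.+ n)
  rec10 = Sum±₁.rec 4

  period3 : ℕ → ℤ
  period3 0 = 0ℤ
  period3 1 = + 1
  period3 2 = - (+ 1)
  period3 (suc (suc (suc m))) = period3 m

  period3-rec : ∀ m → period3 (3 N.+ m) ≡ -1ℤ * period3 (2 N.+ m) + -1ℤ * period3 (1 N.+ m) + 0ℤ * period3 m
  period3-rec zero = refl
  period3-rec (suc zero) = refl
  period3-rec (suc (suc zero)) = refl
  period3-rec (suc (suc (suc m))) = period3-rec m

  Residues : ℕ → ℤ → Set
  Residues n x = (n % 3 ≡ 0 → x ≡ + 1) × (n % 3 ≡ 1 → x ≡ - (+ 1)) × (n % 3 ≡ 2 → x ≡ + 0)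

  period3-residues : ∀ m → Residues (2 N.+ m) (period3 m)
  period3-residues zero = (λ ()) , (λ ()) , (λ _ → refl)
  period3-residues (suc zero) = (λ _ → refl) , (λ ()) , (λ ())
  period3-residues (suc (suc zero)) = (λ ()) , (λ _ → refl) , (λ ())
  period3-residues (suc (suc (suc m))) with period3-residues m
  ... | r₀ , r₁ , r₂ = (λ e → r₀ (trans (sym mod) e)) , (λ e → r₁ (trans (sym mod) e)) , (λ e → r₂ (trans (sym mod) e))
    where
    mod : (2 N.+ (3 N.+ m)) % 3 ≡ (2 N.+ m) % 3
    mod = trans (cong (_% 3) (NP.+-comm 2 (3 N.+ m)))
          (trans (cong (λ z → (3 N.+ z) % 3) (NP.+-comm m 2))
          (trans (cong (_% 3) (NP.+-comm 3 (2 N.+ m))) (ND.[m+n]%n≡m%n (2 N.+ m) 3)))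

  item10 : ∀ n → n ≥ 2 → Residues n (Sum± 4 1 n)
  item10 = from 2 (λ n → Residues n (Sum± 4 1 n)) residues
    where
    agree : ∀ m → Sum± 4 1 (2 N.+ m) ≡ period3 m
    agree = recurrence-unique (λ m → Sum± 4 1 (2 N.+ m)) period3 -1ℤ -1ℤ 0ℤ (λ n → rec10 (suc n)) period3-rec refl refl refl
    residues : ∀ m → Residues (2 N.+ m) (Sum± 4 1 (2 N.+ m))
    residues m with period3-residues m
    ... | r₀ , r₁ , r₂ = (λ e → trans (agree m) (r₀ e)) , (λ e → trans (agree m) (r₁ e)) , (λ e → trans (agree m) (r₂ e))


module PowerFormulas where

  open Recurrences using (recurrence-unique; module Sum⁺₁; module Sum⁺₂)
  open Division using (quotient)
  open import Data.Nat as N using (ℕ; zero; suc; _<_; _≥_; z≤n; s≤s; _/_)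
  import Data.Nat.Properties as NP
  open import Data.Integer using (ℤ; +_; 0ℤ; _+_; _*_; -_)
  import Data.Integer.Properties as ZP
  open import Data.Integer.Tactic.RingSolver using (solve-∀)
  import Data.Nat.Tactic.RingSolver as ℕ-Solver
  open import Data.Product using (_×_; _,_; proj₁)
  open import Relation.Binary.PropositionalEquality
  open ≡-Reasoning

  -- Item 2.  Sum⁺ 0 1 (n+4) = S(n+3) + S(n+2) + 2 S(n+1), the recurrence with
  -- characteristic roots 2 and the primitive cube roots of unity; hence
  -- 2^{m+1} + 6 = rem m + 14 · Sum⁺ 0 1 (m+1) with a 3-periodic remainder.
  rec2 : ∀ n → Sum⁺ 0 1 (4 N.+ n) ≡ + 1 * Sum⁺ 0 1 (3 N.+ n) + + 1 * Sum⁺ 0 1 (2 N.+ n) + + 2 * Sum⁺ 0 1 (1 N.+ n)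
  rec2 = Sum⁺₁.rec 0

  quot : ℕ → ℕ
  quot 0 = 0
  quot 1 = 0
  quot 2 = 1
  quot (suc (suc (suc m))) = quot (suc (suc m)) N.+ quot (suc m) N.+ 2 N.* quot m

  rem : ℕ → ℕ
  rem 0 = 8
  rem 1 = 10
  rem 2 = 0
  rem (suc (suc (suc m))) = rem m

  rem-window : ∀ m → rem m N.+ rem (1 N.+ m) N.+ rem (2 N.+ m) ≡ 18
  rem-window 0 = refl
  rem-window 1 = refl
  rem-window 2 = refl
  rem-window (suc (suc (suc m))) = rem-window m

  rem<14 : ∀ m → rem m < 14
  rem<14 0 = NP.m≤m+n 9 5
  rem<14 1 = NP.m≤m+n 11 3
  rem<14 2 = s≤s z≤n
  rem<14 (suc (suc (suc m))) = rem<14 m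

  Euclid : ℕ → Set
  Euclid m = 2 N.^ (1 N.+ m) N.+ 6 ≡ rem m N.+ quot m N.* 14

  -- 2^{m+4} + 6 = 2(2^{m+1} + 6) + (2^{m+2} + 6) + (2^{m+3} + 6) - 18
  euclid-step : ∀ X r₀ r₁ r₂ g₀ g₁ g₂ → X N.+ 6 ≡ r₀ N.+ g₀ N.* 14 → 2 N.* X N.+ 6 ≡ r₁ N.+ g₁ N.* 14 →
    2 N.* (2 N.* X) N.+ 6 ≡ r₂ N.+ g₂ N.* 14 → r₀ N.+ r₁ N.+ r₂ ≡ 18 →
    2 N.* (2 N.* (2 N.* X)) N.+ 6 ≡ r₀ N.+ (g₂ N.+ g₁ N.+ 2 N.* g₀) N.* 14
  euclid-step X r₀ r₁ r₂ g₀ g₁ g₂ h₀ h₁ h₂ window = NP.+-cancelʳ-≡ 18 _ _ (begin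
    2 N.* (2 N.* (2 N.* X)) N.+ 6 N.+ 18
      ≡⟨ powers X ⟩
    2 N.* (X N.+ 6) N.+ (2 N.* X N.+ 6) N.+ (2 N.* (2 N.* X) N.+ 6)
      ≡⟨ cong₂ N._+_ (cong₂ N._+_ (cong (2 N.*_) h₀) h₁) h₂ ⟩
    2 N.* (r₀ N.+ g₀ N.* 14) N.+ (r₁ N.+ g₁ N.* 14) N.+ (r₂ N.+ g₂ N.* 14)
      ≡⟨ collect r₀ r₁ r₂ g₀ g₁ g₂ ⟩
    r₀ N.+ (g₂ N.+ g₁ N.+ 2 N.* g₀) N.* 14 N.+ (r₀ N.+ r₁ N.+ r₂)
      ≡⟨ cong (r₀ N.+ (g₂ N.+ g₁ N.+ 2 N.* g₀) N.* 14 N.+_) window ⟩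
    r₀ N.+ (g₂ N.+ g₁ N.+ 2 N.* g₀) N.* 14 N.+ 18 ∎)
    where
    powers : ∀ X → 2 N.* (2 N.* (2 N.* X)) N.+ 6 N.+ 18 ≡ 2 N.* (X N.+ 6) N.+ (2 N.* X N.+ 6) N.+ (2 N.* (2 N.* X) N.+ 6)
    powers = ℕ-Solver.solve-∀
    collect : ∀ r₀ r₁ r₂ g₀ g₁ g₂ → 2 N.* (r₀ N.+ g₀ N.* 14) N.+ (r₁ N.+ g₁ N.* 14) N.+ (r₂ N.+ g₂ N.* 14)
              ≡ r₀ N.+ (g₂ N.+ g₁ N.+ 2 N.* g₀) N.* 14 N.+ (r₀ N.+ r₁ N.+ r₂)
    collect = ℕ-Solver.solve-∀

  euclid : ∀ m → Euclid m
  euclid m = proj₁ (window m)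
    where
    window : ∀ m → Euclid m × Euclid (1 N.+ m) × Euclid (2 N.+ m)
    window zero = refl , refl , refl
    window (suc m) with window m
    ... | e₀ , e₁ , e₂ = e₁ , e₂ , euclid-step (2 N.^ (1 N.+ m)) (rem m) (rem (1 N.+ m)) (rem (2 N.+ m))
                                     (quot m) (quot (1 N.+ m)) (quot (2 N.+ m)) e₀ e₁ e₂ (rem-window m)

  item2 : ∀ n → n ≥ 1 → Sum⁺ 0 1 n ≡ + ((2 N.^ n N.+ 6) / 14)
  item2 (suc m) _ = trans (agree m) (cong +_ (sym (trans (cong (_/ 14) (euclid m)) (quotient 14 (quot m) (rem m) (rem<14 m)))))
    where
    quot-rec : ∀ m → + quot (3 N.+ m) ≡ + 1 * + quot (2 N.+ m) + + 1 * + quot (1 N.+ m) + + 2 * + quot m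
    quot-rec m = trans (ZP.pos-+ (quot (2 N.+ m) N.+ quot (1 N.+ m)) (2 N.* quot m))
      (trans (cong₂ _+_ (ZP.pos-+ (quot (2 N.+ m)) (quot (1 N.+ m))) (ZP.pos-* 2 (quot m)))
             (units (+ quot (2 N.+ m)) (+ quot (1 N.+ m)) (+ quot m)))
      where
      units : ∀ x y z → x + y + + 2 * z ≡ + 1 * x + + 1 * y + + 2 * z
      units = solve-∀
    agree : ∀ m → Sum⁺ 0 1 (1 N.+ m) ≡ + quot m
    agree = recurrence-unique (λ m → Sum⁺ 0 1 (1 N.+ m)) (λ m → + quot m) (+ 1) (+ 1) (+ 2) rec2 quot-rec refl refl refl

  -- Item 3.  Sum⁺ 0 2 (n+4) = 3 S(n+3) + 2 S(n+2), so 2^k · Sum⁺ 0 2 (k+2)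
  -- satisfies u(k+2) = 6 u(k+1) + 8 u(k), the recurrence of the real and
  -- imaginary parts a_k, b_k of (3+√17)^k = a_k + b_k √17.  The right-hand side
  -- of item 3 is 34 (a_k + b_k), its conjugate terms cancelling the √17-part.
  rec3 : ∀ n → Sum⁺ 0 2 (4 N.+ n) ≡ + 3 * Sum⁺ 0 2 (3 N.+ n) + + 2 * Sum⁺ 0 2 (2 N.+ n) + 0ℤ * Sum⁺ 0 2 (1 N.+ n)
  rec3 = Sum⁺₂.rec 0

  root conjRoot : ℤ√17
  root = ⟨ + 3 , + 1 ⟩
  conjRoot = ⟨ + 3 , - (+ 1) ⟩

  a b : ℕ → ℤ
  a k = ℤ√17.re (root ^√ k)
  b k = ℤ√17.im (root ^√ k)

  conjugate : ∀ k → (ℤ√17.re (conjRoot ^√ k) ≡ a k) × (ℤ√17.im (conjRoot ^√ k) ≡ - b k)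
  conjugate zero = refl , refl
  conjugate (suc k) with conjugate k
  ... | re , im = trans (cong₂ (λ u v → + 3 * u + + 17 * (- (+ 1) * v)) re im) (re-step (a k) (b k)) ,
                  trans (cong₂ (λ u v → + 3 * v + - (+ 1) * u) re im) (im-step (a k) (b k))
    where
    re-step : ∀ x y → + 3 * x + + 17 * (- (+ 1) * - y) ≡ + 3 * x + + 17 * (+ 1 * y)
    re-step = solve-∀
    im-step : ∀ x y → + 3 * - y + - (+ 1) * x ≡ - (+ 3 * y + + 1 * x)
    im-step = solve-∀

  u : ℕ → ℤ
  u k = a k + b k

  u-rec : ∀ k → u (3 N.+ k) ≡ + 6 * u (2 N.+ k) + + 8 * u (1 N.+ k) + 0ℤ * u k
  u-rec k = trans (square (a (1 N.+ k)) (b (1 N.+ k))) (sym (ZP.+-identityʳ _))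
    where
    square : ∀ x y → (+ 3 * (+ 3 * x + + 17 * (+ 1 * y)) + + 17 * (+ 1 * (+ 3 * y + + 1 * x)))
                      + (+ 3 * (+ 3 * y + + 1 * x) + + 1 * (+ 3 * x + + 17 * (+ 1 * y)))
                   ≡ + 6 * ((+ 3 * x + + 17 * (+ 1 * y)) + (+ 3 * y + + 1 * x)) + + 8 * (x + y)
    square = solve-∀

  v : ℕ → ℤ
  v k = + (2 N.^ k) * Sum⁺ 0 2 (2 N.+ k)

  v-rec : ∀ k → v (3 N.+ k) ≡ + 6 * v (2 N.+ k) + + 8 * v (1 N.+ k) + 0ℤ * v k
  v-rec k = begin
    + (2 N.^ (3 N.+ k)) * Sum⁺ 0 2 (5 N.+ k)
      ≡⟨ cong₂ _*_ (trans (ZP.pos-* 2 (2 N.^ (2 N.+ k))) (cong (+ 2 *_) (ZP.pos-* 2 (2 N.^ (1 N.+ k))))) (rec3 (1 N.+ k)) ⟩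
    (+ 2 * (+ 2 * + (2 N.^ (1 N.+ k)))) * (+ 3 * Sum⁺ 0 2 (4 N.+ k) + + 2 * Sum⁺ 0 2 (3 N.+ k) + 0ℤ * Sum⁺ 0 2 (2 N.+ k))
      ≡⟨ rescale (+ (2 N.^ (1 N.+ k))) (Sum⁺ 0 2 (4 N.+ k)) (Sum⁺ 0 2 (3 N.+ k)) (Sum⁺ 0 2 (2 N.+ k)) (v k) ⟩
    + 6 * ((+ 2 * + (2 N.^ (1 N.+ k))) * Sum⁺ 0 2 (4 N.+ k)) + + 8 * (+ (2 N.^ (1 N.+ k)) * Sum⁺ 0 2 (3 N.+ k)) + 0ℤ * v k
      ≡⟨ cong (λ z → + 6 * (z * Sum⁺ 0 2 (4 N.+ k)) + + 8 * v (1 N.+ k) + 0ℤ * v k) (sym (ZP.pos-* 2 (2 N.^ (1 N.+ k)))) ⟩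
    + 6 * v (2 N.+ k) + + 8 * v (1 N.+ k) + 0ℤ * v k ∎
    where
    rescale : ∀ t s₄ s₃ s₂ w → (+ 2 * (+ 2 * t)) * (+ 3 * s₄ + + 2 * s₃ + 0ℤ * s₂)
                               ≡ + 6 * ((+ 2 * t) * s₄) + + 8 * (t * s₃) + 0ℤ * w
    rescale = solve-∀

  v≡u : ∀ k → v k ≡ u k
  v≡u = recurrence-unique v u (+ 6) (+ 8) 0ℤ v-rec u-rec refl refl refl

  item3 : ∀ n → n ≥ 2 →
    embed (+ (34 N.* 2 N.^ (n N.∸ 2)) * Sum⁺ 0 2 n)
      ≡ (⟨ + 17 , + 1 ⟩ ⊗ (⟨ + 3 , + 1 ⟩ ^√ (n N.∸ 2))) ⊕ (⟨ + 17 , - (+ 1) ⟩ ⊗ (⟨ + 3 , - (+ 1) ⟩ ^√ (n N.∸ 2)))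
  item3 (suc zero) (s≤s ())
  item3 (suc (suc k)) _ with conjugate k
  ... | re , im = cong₂ ⟨_,_⟩ re-part im-part
    where
    Q : ℤ√17
    Q = (⟨ + 17 , + 1 ⟩ ⊗ (root ^√ k)) ⊕ (⟨ + 17 , - (+ 1) ⟩ ⊗ (conjRoot ^√ k))
    real : ∀ x y → + 34 * (x + y) ≡ (+ 17 * x + + 17 * (+ 1 * y)) + (+ 17 * x + + 17 * (- (+ 1) * - y))
    real = solve-∀
    cancel : ∀ x y → + 0 ≡ (+ 17 * y + + 1 * x) + (+ 17 * - y + - (+ 1) * x)
    cancel = solve-∀
    re-part : + (34 N.* 2 N.^ k) * Sum⁺ 0 2 (2 N.+ k) ≡ ℤ√17.re Q
    re-part = begin
      + (34 N.* 2 N.^ k) * Sum⁺ 0 2 (2 N.+ k)    ≡⟨ cong (_* Sum⁺ 0 2 (2 N.+ k)) (ZP.pos-* 34 (2 N.^ k)) ⟩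
      + 34 * + (2 N.^ k) * Sum⁺ 0 2 (2 N.+ k)    ≡⟨ ZP.*-assoc (+ 34) (+ (2 N.^ k)) _ ⟩
      + 34 * v k                                 ≡⟨ cong (+ 34 *_) (v≡u k) ⟩
      + 34 * u k                                 ≡⟨ real (a k) (b k) ⟩
      (+ 17 * a k + + 17 * (+ 1 * b k)) + (+ 17 * a k + + 17 * (- (+ 1) * - b k))
        ≡⟨ cong₂ (λ x y → (+ 17 * a k + + 17 * (+ 1 * b k)) + (+ 17 * x + + 17 * (- (+ 1) * y))) (sym re) (sym im) ⟩
      ℤ√17.re Q ∎
    im-part : + 0 ≡ ℤ√17.im Q
    im-part = trans (cancel (a k) (b k))
      (cong₂ (λ x y → (+ 17 * b k + + 1 * a k) + (+ 17 * y + - (+ 1) * x)) (sym re) (sym im))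


module NatSums where

  open import Data.Nat as N using (ℕ; zero; suc; _≤_; _<_; z≤n; s≤s; _+_; _*_; _∸_)
  import Data.Nat.Properties as NP
  open import Data.Nat.Combinatorics using (_C_; nCk+nC[k+1]≡[n+1]C[k+1])
  import Data.Nat.Tactic.RingSolver as ℕ-Solver
  open import Relation.Nullary using (yes; no)
  open import Relation.Binary.PropositionalEquality
  open ≡-Reasoning

  Σ<-front : ∀ N (f : ℕ → ℕ) → Σ< (suc N) f ≡ f 0 + Σ< N (λ i → f (suc i))
  Σ<-front zero f = NP.+-comm 0 (f 0)
  Σ<-front (suc N) f = trans (cong (_+ f (suc N)) (Σ<-front N f)) (NP.+-assoc (f 0) _ _)

  Σ<-cong : ∀ N {f g : ℕ → ℕ} → (∀ i → f i ≡ g i) → Σ< N f ≡ Σ< N g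
  Σ<-cong zero e = refl
  Σ<-cong (suc N) e = cong₂ _+_ (Σ<-cong N e) (e N)

  Σ<-cong< : ∀ N {f g : ℕ → ℕ} → (∀ i → i < N → f i ≡ g i) → Σ< N f ≡ Σ< N g
  Σ<-cong< zero e = refl
  Σ<-cong< (suc N) e = cong₂ _+_ (Σ<-cong< N (λ i lt → e i (NP.m<n⇒m<1+n lt))) (e N NP.≤-refl)

  Σ<-+ : ∀ N (f g : ℕ → ℕ) → Σ< N (λ i → f i + g i) ≡ Σ< N f + Σ< N g
  Σ<-+ zero f g = refl
  Σ<-+ (suc N) f g = trans (cong (_+ (f N + g N)) (Σ<-+ N f g)) (interchange (Σ< N f) (Σ< N g) (f N) (g N))
    where
    interchange : ∀ a b c d → a + b + (c + d) ≡ a + c + (b + d)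
    interchange = ℕ-Solver.solve-∀

  Σ<-scale : ∀ N c (f : ℕ → ℕ) → Σ< N (λ i → c * f i) ≡ c * Σ< N f
  Σ<-scale zero c f = sym (NP.*-zeroʳ c)
  Σ<-scale (suc N) c f = trans (cong (_+ c * f N) (Σ<-scale N c f)) (sym (NP.*-distribˡ-+ c (Σ< N f) (f N)))

  Σ<-truncate : ∀ K N (f : ℕ → ℕ) → (∀ i → K ≤ i → f i ≡ 0) → K ≤ N → Σ< N f ≡ Σ< K f
  Σ<-truncate K zero f z K≤0 rewrite NP.n≤0⇒n≡0 K≤0 = refl
  Σ<-truncate K (suc N) f z K≤sN with K N.≟ suc N
  ... | yes refl = refl
  ... | no K≢sN = trans (cong₂ _+_ (Σ<-truncate K N f z K≤N) (z N K≤N)) (NP.+-identityʳ _)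
    where
    K≤N : K ≤ N
    K≤N = NP.≤-pred (NP.≤∧≢⇒< K≤sN K≢sN)

  Σ<-pairs : ∀ N (f : ℕ → ℕ) → Σ< (2 * N) f ≡ Σ< N (λ j → f (2 * j) + f (suc (2 * j)))
  Σ<-pairs zero f = refl
  Σ<-pairs (suc N) f = begin
    Σ< (2 * suc N) f                                    ≡⟨ cong (λ z → Σ< z f) (NP.*-suc 2 N) ⟩
    Σ< (2 * N) f + f (2 * N) + f (suc (2 * N))          ≡⟨ NP.+-assoc (Σ< (2 * N) f) _ _ ⟩
    Σ< (2 * N) f + (f (2 * N) + f (suc (2 * N)))        ≡⟨ cong (_+ (f (2 * N) + f (suc (2 * N)))) (Σ<-pairs N f) ⟩
    Σ< N (λ j → f (2 * j) + f (suc (2 * j))) + (f (2 * N) + f (suc (2 * N))) ∎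

  -- Pascal's rule with the top argument decreased by a truncated t; when the
  -- subtraction truncates both sides are 0, which needs k > 0
  pascal-∸ : ∀ m t k → (m < t → 0 < k) → ((1 + m) ∸ t) C suc k ≡ (m ∸ t) C suc k + (m ∸ t) C k
  pascal-∸ m t k k>0 with t N.≤? m
  ... | yes t≤m = begin
    ((1 + m) ∸ t) C suc k           ≡⟨ cong (_C suc k) (NP.+-∸-assoc 1 t≤m) ⟩
    suc (m ∸ t) C suc k             ≡⟨ sym (nCk+nC[k+1]≡[n+1]C[k+1] (m ∸ t) k) ⟩
    (m ∸ t) C k + (m ∸ t) C suc k   ≡⟨ NP.+-comm ((m ∸ t) C k) _ ⟩
    (m ∸ t) C suc k + (m ∸ t) C k ∎
  ... | no t≰m = truncated k (k>0 m<t)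
    where
    m<t : m < t
    m<t = NP.≰⇒> t≰m
    truncated : ∀ k → 0 < k → ((1 + m) ∸ t) C suc k ≡ (m ∸ t) C suc k + (m ∸ t) C k
    truncated (suc k) _ rewrite NP.m≤n⇒m∸n≡0 m<t | NP.m≤n⇒m∸n≡0 (NP.<⇒≤ m<t) = refl

  positive-half : ∀ m j → m < 2 * j → 0 < j
  positive-half m (suc j) _ = s≤s z≤n


module SkewBinomialSums where

  open NatSums
  open import Data.Nat as N using (ℕ; suc; _≤_; _<_; _+_; _*_; _∸_)
  import Data.Nat.Properties as NP
  open import Data.Nat.Combinatorics using (_C_; k>n⇒nCk≡0)
  import Data.Nat.Tactic.RingSolver as ℕ-Solver
  open import Relation.Binary.PropositionalEquality
  open ≡-Reasoning

  skew : ℕ → ℕ → ℕ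
  skew m i = (m ∸ 2 * i) C i

  skew-vanish : ∀ m K → m < 3 * K → ∀ i → K ≤ i → skew m i ≡ 0
  skew-vanish m K lt i K≤i = vanish i (NP.<-≤-trans lt (NP.*-monoʳ-≤ 3 K≤i))
    where
    split : ∀ i → 3 * suc i ≡ 2 * suc i + suc i
    split = ℕ-Solver.solve-∀
    vanish : ∀ i → m < 3 * i → skew m i ≡ 0
    vanish (suc i) lt = k>n⇒nCk≡0 (NP.m<n+o⇒m∸n<o m (2 * suc i) (subst (m <_) (split i) lt))

  S : ℕ → ℕ
  S m = Σ< (suc m) (skew m)

  S-cut : ∀ m K → m < 3 * K → K ≤ suc m → Σ< K (skew m) ≡ S m
  S-cut m K lt le = sym (Σ<-truncate K (suc m) (skew m) (skew-vanish m K lt) le)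

  S-extend : ∀ N m → suc m ≤ N → Σ< N (skew m) ≡ S m
  S-extend N m le = Σ<-truncate (suc m) N (skew m) (skew-vanish m (suc m) (NP.m≤n*m (suc m) 3)) le

  skew-pascal : ∀ m i → skew (3 + m) (suc i) ≡ skew (2 + m) (suc i) + skew m i
  skew-pascal m i = begin
    ((3 + m) ∸ 2 * suc i) C suc i                   ≡⟨ cong (λ t → ((3 + m) ∸ t) C suc i) (NP.*-suc 2 i) ⟩
    ((1 + m) ∸ 2 * i) C suc i                       ≡⟨ pascal-∸ m (2 * i) i (positive-half m i) ⟩
    (m ∸ 2 * i) C suc i + skew m i                  ≡⟨ cong (λ t → ((2 + m) ∸ t) C suc i + skew m i) (sym (NP.*-suc 2 i)) ⟩
    skew (2 + m) (suc i) + skew m i ∎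

  S-rec : ∀ m → S (3 + m) ≡ S (2 + m) + S m
  S-rec m = begin
    Σ< (4 + m) (skew (3 + m))
      ≡⟨ Σ<-front (3 + m) (skew (3 + m)) ⟩
    1 + Σ< (3 + m) (λ i → skew (3 + m) (suc i))
      ≡⟨ cong (1 +_) (trans (Σ<-cong (3 + m) (skew-pascal m)) (Σ<-+ (3 + m) (λ i → skew (2 + m) (suc i)) (skew m))) ⟩
    1 + (Σ< (3 + m) (λ i → skew (2 + m) (suc i)) + Σ< (3 + m) (skew m))
      ≡⟨ sym (NP.+-assoc 1 (Σ< (3 + m) (λ i → skew (2 + m) (suc i))) (Σ< (3 + m) (skew m))) ⟩
    (1 + Σ< (3 + m) (λ i → skew (2 + m) (suc i))) + Σ< (3 + m) (skew m)
      ≡⟨ cong₂ _+_ (sym (Σ<-front (3 + m) (skew (2 + m)))) (S-extend (3 + m) m (NP.m≤n+m (suc m) 2)) ⟩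
    Σ< (4 + m) (skew (2 + m)) + S m
      ≡⟨ cong (_+ S m) (S-extend (4 + m) (2 + m) (NP.n≤1+n (3 + m))) ⟩
    S (2 + m) + S m ∎


-- Items 4 and 5: Sum± 1 1 (m+2) = -S(m) and Sum⁺ 1 1 (k+2) = S(2k).
module SkewBinomialItems where

  open NatSums
  open SkewBinomialSums
  open Recurrences using (recurrence-unique; module Sum±₁; module Sum⁺₁)
  open Division using (below-next-multiple)
  open import Data.Nat as N using (ℕ; zero; suc; _≤_; _<_; _≥_; s≤s; _/_)
  import Data.Nat.Properties as NP
  import Data.Nat.DivMod as ND
  open import Data.Nat.Combinatorics using (_C_)
  open import Data.Integer using (ℤ; +_; 0ℤ; _+_; _*_; -_)
  import Data.Integer.Properties as ZP
  open import Data.Integer.Tactic.RingSolver using (solve-∀)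
  import Data.Nat.Tactic.RingSolver as ℕ-Solver
  open import Relation.Binary.PropositionalEquality
  open ≡-Reasoning

  rec4 : ∀ n → Sum± 1 1 (4 N.+ n) ≡ + 1 * Sum± 1 1 (3 N.+ n) + 0ℤ * Sum± 1 1 (2 N.+ n) + + 1 * Sum± 1 1 (1 N.+ n)
  rec4 = Sum±₁.rec 1

  item4 : ∀ n → n ≥ 1 → Sum± 1 1 n ≡ - (+ Σ< ((n N.+ 1) / 3) (λ i → (n N.∸ 2 N.∸ 2 N.* i) C i))
  item4 (suc zero) _ = refl
  item4 (suc (suc m)) _ = trans (agree m) (cong (λ z → - (+ z)) (sym (S-cut m K m<3K K≤m+1)))
    where
    K = (suc (suc m) N.+ 1) / 3
    plus3 : ∀ m → suc (suc m) N.+ 1 ≡ m N.+ 3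
    plus3 = ℕ-Solver.solve-∀
    m<3K : m < 3 N.* K
    m<3K = NP.+-cancelʳ-< 3 m (3 N.* K) (subst₂ _<_ (plus3 m) (shift3 K) (below-next-multiple 3 (suc (suc m) N.+ 1)))
      where
      shift3 : ∀ K → 3 N.* (K N.+ 1) ≡ 3 N.* K N.+ 3
      shift3 = ℕ-Solver.solve-∀
    K≤m+1 : K ≤ suc m
    K≤m+1 = NP.≤-trans (ND./-monoˡ-≤ 3 (NP.≤-trans (NP.≤-reflexive (plus3 m)) (NP.+-monoˡ-≤ 3 (NP.m≤m*n m 3))))
                       (NP.≤-reflexive (trans (cong (_/ 3) (times3 m)) (ND.m*n/n≡m (suc m) 3)))
      where
      times3 : ∀ m → m N.* 3 N.+ 3 ≡ suc m N.* 3
      times3 = ℕ-Solver.solve-∀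
    negS : ℕ → ℤ
    negS m = - (+ S m)
    negS-rec : ∀ m → negS (3 N.+ m) ≡ + 1 * negS (2 N.+ m) + 0ℤ * negS (1 N.+ m) + + 1 * negS m
    negS-rec m = trans (cong (λ z → - (+ z)) (S-rec m))
      (trans (cong -_ (ZP.pos-+ (S (2 N.+ m)) (S m))) (distrib (+ S (2 N.+ m)) (+ S m) (negS (1 N.+ m))))
      where
      distrib : ∀ x y z → - (x + y) ≡ + 1 * - x + 0ℤ * z + + 1 * - y
      distrib = solve-∀
    agree : ∀ m → Sum± 1 1 (2 N.+ m) ≡ negS m
    agree = recurrence-unique (λ m → Sum± 1 1 (2 N.+ m)) negS (+ 1) 0ℤ (+ 1) (λ n → rec4 (suc n)) negS-rec refl refl refl

  -- Item 5.  Sum⁺ 1 1 (n+4) = Sum⁺ 1 1 (n+3) + 2 Sum⁺ 1 1 (n+2) + Sum⁺ 1 1 (n+1),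
  -- which is also the recurrence of the even-indexed values S(2k).
  rec5 : ∀ n → Sum⁺ 1 1 (4 N.+ n) ≡ + 1 * Sum⁺ 1 1 (3 N.+ n) + + 2 * Sum⁺ 1 1 (2 N.+ n) + + 1 * Sum⁺ 1 1 (1 N.+ n)
  rec5 = Sum⁺₁.rec 1

  S-even-rec : ∀ k → S (2 N.* (3 N.+ k)) ≡ S (2 N.* (2 N.+ k)) N.+ 2 N.* S (2 N.* (1 N.+ k)) N.+ S (2 N.* k)
  S-even-rec k = begin
    S (2 N.* (3 N.+ k))                                        ≡⟨ cong S (index6 k) ⟩
    S (3 N.+ (3 N.+ j))                                        ≡⟨ S-rec (3 N.+ j) ⟩
    S (2 N.+ (3 N.+ j)) N.+ S (3 N.+ j)                        ≡⟨ cong₂ N._+_ (S-rec (2 N.+ j)) (S-rec j) ⟩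
    (S (2 N.+ (2 N.+ j)) N.+ S (2 N.+ j)) N.+ (S (2 N.+ j) N.+ S j)
      ≡⟨ collect (S (2 N.+ (2 N.+ j))) (S (2 N.+ j)) (S j) ⟩
    S (2 N.+ (2 N.+ j)) N.+ 2 N.* S (2 N.+ j) N.+ S j
      ≡⟨ cong₂ (λ a b → S a N.+ 2 N.* S b N.+ S j) (sym (index4 k)) (sym (index2 k)) ⟩
    S (2 N.* (2 N.+ k)) N.+ 2 N.* S (2 N.* (1 N.+ k)) N.+ S (2 N.* k) ∎
    where
    j = 2 N.* k
    index6 : ∀ k → 2 N.* (3 N.+ k) ≡ 3 N.+ (3 N.+ 2 N.* k)
    index6 = ℕ-Solver.solve-∀
    index4 : ∀ k → 2 N.* (2 N.+ k) ≡ 2 N.+ (2 N.+ 2 N.* k)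
    index4 = ℕ-Solver.solve-∀
    index2 : ∀ k → 2 N.* (1 N.+ k) ≡ 2 N.+ 2 N.* k
    index2 = ℕ-Solver.solve-∀
    collect : ∀ a b c → (a N.+ b) N.+ (b N.+ c) ≡ a N.+ 2 N.* b N.+ c
    collect = ℕ-Solver.solve-∀

  item5 : ∀ n → n ≥ 2 → Sum⁺ 1 1 n ≡ + Σ< ((2 N.* n N.∸ 4) / 3 N.+ 1) (λ i → (2 N.* n N.∸ 4 N.∸ 2 N.* i) C i)
  item5 (suc zero) (s≤s ())
  item5 (suc (suc k)) _ = trans (agree k) (cong +_ (trans (cong S (sym j≡2k))
    (sym (S-cut j (j / 3 N.+ 1) (below-next-multiple 3 j) (subst (_≤ suc j) (NP.+-comm 1 (j / 3)) (s≤s (ND.m/n≤m j 3)))))))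
    where
    j = 2 N.* suc (suc k) N.∸ 4
    j≡2k : j ≡ 2 N.* k
    j≡2k = trans (cong (N._∸ 4) (double k)) (NP.m+n∸m≡n 4 (2 N.* k))
      where
      double : ∀ k → 2 N.* suc (suc k) ≡ 4 N.+ 2 N.* k
      double = ℕ-Solver.solve-∀
    evenS : ℕ → ℤ
    evenS k = + S (2 N.* k)
    evenS-rec : ∀ k → evenS (3 N.+ k) ≡ + 1 * evenS (2 N.+ k) + + 2 * evenS (1 N.+ k) + + 1 * evenS k
    evenS-rec k = trans (cong +_ (S-even-rec k))
      (trans (ZP.pos-+ (S (2 N.* (2 N.+ k)) N.+ 2 N.* S (2 N.* (1 N.+ k))) (S (2 N.* k)))
      (trans (cong (_+ evenS k) (trans (ZP.pos-+ (S (2 N.* (2 N.+ k))) (2 N.* S (2 N.* (1 N.+ k))))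
                                       (cong (_+_ (evenS (2 N.+ k))) (ZP.pos-* 2 (S (2 N.* (1 N.+ k)))))))
             (units (evenS (2 N.+ k)) (evenS (1 N.+ k)) (evenS k))))
      where
      units : ∀ x y z → x + + 2 * y + z ≡ + 1 * x + + 2 * y + + 1 * z
      units = solve-∀
    agree : ∀ k → Sum⁺ 1 1 (2 N.+ k) ≡ evenS k
    agree = recurrence-unique (λ k → Sum⁺ 1 1 (2 N.+ k)) evenS (+ 1) (+ 2) (+ 1) (λ n → rec5 (suc n)) evenS-rec refl refl refl


-- Item 12.  With A_r(n) = Σ_i C(n+i, r+3i) (r = 0, 1, 2), Pascal's rule gives
--   A₁(n+1) = A₀(n) + A₁(n),  A₂(n+1) = A₁(n) + A₂(n),  A₀(n+1) = A₀(n) + A₂(n+1),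
-- whence A₁(k+3) + 2 A₁(k+1) = 3 A₁(k+2) + A₁(k).  This matches the recurrence
-- S(n+4) = -3 S(n+3) - 2 S(n+2) - S(n+1) of Sum± 5 1 up to the sign (-1)^n, and
-- the symmetry C(N, K) = C(N, N-K) turns A₁(n+2) into the sum of the statement.
module Item12 where

  open NatSums
  open Division using (below-next-multiple)
  open Recurrences using (recurrence-unique; module Sum±₁)
  open import Data.Nat as N using (ℕ; suc; _≤_; _<_; _≥_; s≤s; _/_)
  import Data.Nat.Properties as NP
  import Data.Nat.DivMod as ND
  open import Data.Nat.Combinatorics using (_C_; k>n⇒nCk≡0; nCk+nC[k+1]≡[n+1]C[k+1]; nCk≡nC[n∸k])
  open import Data.Integer using (ℤ; +_; _+_; _*_; -_; _-_)
  import Data.Integer.Properties as ZP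
  open import Data.Integer.Tactic.RingSolver using (solve-∀)
  import Data.Nat.Tactic.RingSolver as ℕ-Solver
  open import Relation.Binary.PropositionalEquality
  open ≡-Reasoning

  trisect : ℕ → ℕ → ℕ → ℕ
  trisect r N n = Σ< N (λ i → (n N.+ i) C (r N.+ 3 N.* i))

  trisect-vanish : ∀ r n i → suc n ≤ i → (n N.+ i) C (r N.+ 3 N.* i) ≡ 0
  trisect-vanish r n i le = k>n⇒nCk≡0 (NP.<-≤-trans (NP.+-monoˡ-< i le)
    (NP.≤-trans (NP.+-monoʳ-≤ i (NP.m≤m+n i (i N.+ 0))) (NP.m≤n+m (3 N.* i) r)))

  tri : ℕ → ℕ → ℕ
  tri r n = trisect r (suc n) n

  trisect-extend : ∀ r N n → suc n ≤ N → trisect r N n ≡ tri r n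
  trisect-extend r N n le = Σ<-truncate (suc n) N _ (trisect-vanish r n) le

  trisect-step₁ : ∀ N n → trisect 1 N (suc n) ≡ trisect 0 N n N.+ trisect 1 N n
  trisect-step₁ N n = trans (Σ<-cong N (λ i → sym (nCk+nC[k+1]≡[n+1]C[k+1] (n N.+ i) (3 N.* i)))) (Σ<-+ N _ _)

  trisect-step₂ : ∀ N n → trisect 2 N (suc n) ≡ trisect 1 N n N.+ trisect 2 N n
  trisect-step₂ N n = trans (Σ<-cong N (λ i → sym (nCk+nC[k+1]≡[n+1]C[k+1] (n N.+ i) (1 N.+ 3 N.* i)))) (Σ<-+ N _ _)

  trisect-step₀ : ∀ N n → trisect 0 (suc N) (suc n) ≡ trisect 0 (suc N) n N.+ trisect 2 N (suc n)
  trisect-step₀ N n = begin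
    trisect 0 (suc N) (suc n)
      ≡⟨ Σ<-front N _ ⟩
    1 N.+ Σ< N (λ i → (suc n N.+ suc i) C (3 N.* suc i))
      ≡⟨ cong (1 N.+_) (Σ<-cong N (λ i → trans (cong (λ z → (suc n N.+ suc i) C z) (NP.*-suc 3 i))
            (sym (nCk+nC[k+1]≡[n+1]C[k+1] (n N.+ suc i) (2 N.+ 3 N.* i))))) ⟩
    1 N.+ Σ< N (λ i → (n N.+ suc i) C (2 N.+ 3 N.* i) N.+ (n N.+ suc i) C (3 N.+ 3 N.* i))
      ≡⟨ cong (1 N.+_) (Σ<-+ N _ _) ⟩
    1 N.+ (Σ< N (λ i → (n N.+ suc i) C (2 N.+ 3 N.* i)) N.+ Σ< N (λ i → (n N.+ suc i) C (3 N.+ 3 N.* i)))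
      ≡⟨ rotate 1 (Σ< N (λ i → (n N.+ suc i) C (2 N.+ 3 N.* i))) (Σ< N (λ i → (n N.+ suc i) C (3 N.+ 3 N.* i))) ⟩
    (1 N.+ Σ< N (λ i → (n N.+ suc i) C (3 N.+ 3 N.* i))) N.+ Σ< N (λ i → (n N.+ suc i) C (2 N.+ 3 N.* i))
      ≡⟨ cong₂ N._+_ (sym (trans (Σ<-front N _) (cong (1 N.+_) (Σ<-cong N (λ i → cong (λ z → (n N.+ suc i) C z) (NP.*-suc 3 i))))))
                     (Σ<-cong N (λ i → cong (λ z → z C (2 N.+ 3 N.* i)) (NP.+-suc n i))) ⟩
    trisect 0 (suc N) n N.+ trisect 2 N (suc n) ∎
    where
    rotate : ∀ a b c → a N.+ (b N.+ c) ≡ (a N.+ c) N.+ b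
    rotate = ℕ-Solver.solve-∀

  tri-step₁ : ∀ n → tri 1 (suc n) ≡ tri 0 n N.+ tri 1 n
  tri-step₁ n = trans (sym (trisect-extend 1 (suc (suc n)) (suc n) NP.≤-refl)) (trans (trisect-step₁ (suc (suc n)) n)
    (cong₂ N._+_ (trisect-extend 0 (suc (suc n)) n (NP.n≤1+n _)) (trisect-extend 1 (suc (suc n)) n (NP.n≤1+n _))))

  tri-step₂ : ∀ n → tri 2 (suc n) ≡ tri 1 n N.+ tri 2 n
  tri-step₂ n = trans (sym (trisect-extend 2 (suc (suc n)) (suc n) NP.≤-refl)) (trans (trisect-step₂ (suc (suc n)) n)
    (cong₂ N._+_ (trisect-extend 1 (suc (suc n)) n (NP.n≤1+n _)) (trisect-extend 2 (suc (suc n)) n (NP.n≤1+n _))))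

  tri-step₀ : ∀ n → tri 0 (suc n) ≡ tri 0 n N.+ tri 2 (suc n)
  tri-step₀ n = trans (sym (trisect-extend 0 (suc (suc (suc n))) (suc n) (NP.n≤1+n _))) (trans (trisect-step₀ (suc (suc n)) n)
    (cong₂ N._+_ (trisect-extend 0 (suc (suc (suc n))) n (NP.≤-trans (NP.n≤1+n _) (NP.n≤1+n _)))
                 (trisect-extend 2 (suc (suc n)) (suc n) NP.≤-refl)))

  -- eliminating A₀ and A₂ from seven instances of the three steps
  eliminate : ∀ x₀ y₀ z₀ y₁ z₁ x₁ y₂ z₂ x₂ y₃ →
    y₁ ≡ x₀ N.+ y₀ → z₁ ≡ y₀ N.+ z₀ → x₁ ≡ x₀ N.+ z₁ → y₂ ≡ x₁ N.+ y₁ → z₂ ≡ y₁ N.+ z₁ → x₂ ≡ x₁ N.+ z₂ →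
    y₃ ≡ x₂ N.+ y₂ → y₃ N.+ 2 N.* y₁ ≡ 3 N.* y₂ N.+ y₀
  eliminate x₀ y₀ z₀ _ _ _ _ _ _ _ refl refl refl refl refl refl refl = identity x₀ y₀ z₀
    where
    identity : ∀ x₀ y₀ z₀ →
      (((x₀ N.+ (y₀ N.+ z₀)) N.+ ((x₀ N.+ y₀) N.+ (y₀ N.+ z₀))) N.+ ((x₀ N.+ (y₀ N.+ z₀)) N.+ (x₀ N.+ y₀)))
        N.+ 2 N.* (x₀ N.+ y₀)
      ≡ 3 N.* ((x₀ N.+ (y₀ N.+ z₀)) N.+ (x₀ N.+ y₀)) N.+ y₀
    identity = ℕ-Solver.solve-∀

  tri₁-rec : ∀ k → tri 1 (3 N.+ k) N.+ 2 N.* tri 1 (1 N.+ k) ≡ 3 N.* tri 1 (2 N.+ k) N.+ tri 1 k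
  tri₁-rec k = eliminate (tri 0 k) (tri 1 k) (tri 2 k) (tri 1 (1 N.+ k)) (tri 2 (1 N.+ k)) (tri 0 (1 N.+ k))
    (tri 1 (2 N.+ k)) (tri 2 (2 N.+ k)) (tri 0 (2 N.+ k)) (tri 1 (3 N.+ k))
    (tri-step₁ k) (tri-step₂ k) (tri-step₀ k) (tri-step₁ (1 N.+ k)) (tri-step₂ (1 N.+ k)) (tri-step₀ (1 N.+ k))
    (tri-step₁ (2 N.+ k))

  tail-vanish : ∀ n i → n N.+ 1 < 2 N.* i → (n N.+ 2 N.+ i) C (1 N.+ 3 N.* i) ≡ 0
  tail-vanish n i lt = k>n⇒nCk≡0 (subst₂ _<_ (sym (regroup n i)) (triple i) (NP.+-monoˡ-< (1 N.+ i) lt))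
    where
    regroup : ∀ n i → n N.+ 2 N.+ i ≡ n N.+ 1 N.+ (1 N.+ i)
    regroup = ℕ-Solver.solve-∀
    triple : ∀ i → 2 N.* i N.+ (1 N.+ i) ≡ 1 N.+ 3 N.* i
    triple = ℕ-Solver.solve-∀

  mirror : ∀ n i → 2 N.* i ≤ n N.+ 1 → (n N.+ 2 N.+ i) C (n N.+ 1 N.∸ 2 N.* i) ≡ (n N.+ 2 N.+ i) C (1 N.+ 3 N.* i)
  mirror n i 2i≤ = trans (nCk≡nC[n∸k] (subst (t ≤_) (sym total) (NP.m≤m+n t _)))
                         (cong ((n N.+ 2 N.+ i) C_) (trans (cong (N._∸ t) total) (NP.m+n∸m≡n t (1 N.+ 3 N.* i))))
    where
    t = n N.+ 1 N.∸ 2 N.* i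
    total : n N.+ 2 N.+ i ≡ t N.+ (1 N.+ 3 N.* i)
    total = trans (regroup n i) (trans (cong (N._+ (1 N.+ i)) (sym (NP.m+[n∸m]≡n 2i≤))) (collect i t))
      where
      regroup : ∀ n i → n N.+ 2 N.+ i ≡ n N.+ 1 N.+ (1 N.+ i)
      regroup = ℕ-Solver.solve-∀
      collect : ∀ i t → 2 N.* i N.+ t N.+ (1 N.+ i) ≡ t N.+ (1 N.+ 3 N.* i)
      collect = ℕ-Solver.solve-∀

  Y : ℕ → ℕ
  Y n = tri 1 (2 N.+ n)

  Y-closed-form : ∀ n → Y n ≡ Σ< ((n N.+ 1) / 2 N.+ 1) (λ i → (n N.+ 2 N.+ i) C (n N.+ 1 N.∸ 2 N.* i))
  Y-closed-form n = begin
    Σ< (3 N.+ n) (λ i → ((2 N.+ n) N.+ i) C (1 N.+ 3 N.* i))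
      ≡⟨ Σ<-cong (3 N.+ n) (λ i → cong (λ z → (z N.+ i) C (1 N.+ 3 N.* i)) (NP.+-comm 2 n)) ⟩
    Σ< (3 N.+ n) h
      ≡⟨ Σ<-truncate K (3 N.+ n) h (λ i K≤i → tail-vanish n i (NP.<-≤-trans (below-next-multiple 2 (n N.+ 1)) (NP.*-monoʳ-≤ 2 K≤i))) K≤ ⟩
    Σ< K h
      ≡⟨ Σ<-cong< K (λ i i<K → sym (mirror n i (2i≤ i i<K))) ⟩
    Σ< K (λ i → (n N.+ 2 N.+ i) C (n N.+ 1 N.∸ 2 N.* i)) ∎
    where
    K = (n N.+ 1) / 2 N.+ 1
    h : ℕ → ℕ
    h i = (n N.+ 2 N.+ i) C (1 N.+ 3 N.* i)
    K≤ : K ≤ 3 N.+ n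
    K≤ = subst (_≤ 3 N.+ n) (NP.+-comm 1 ((n N.+ 1) / 2))
      (s≤s (NP.≤-trans (ND.m/n≤m (n N.+ 1) 2) (NP.≤-trans (NP.≤-reflexive (NP.+-comm n 1)) (NP.n≤1+n (suc n)))))
    2i≤ : ∀ i → i < K → 2 N.* i ≤ n N.+ 1
    2i≤ i i<K = NP.≤-trans (NP.*-monoʳ-≤ 2 (NP.≤-pred (subst (i <_) (NP.+-comm ((n N.+ 1) / 2) 1) i<K)))
                  (NP.≤-trans (NP.≤-reflexive (NP.*-comm 2 ((n N.+ 1) / 2))) (ND.m/n*n≤m (n N.+ 1) 2))

  -1ℤ -2ℤ -3ℤ : ℤ
  -1ℤ = - (+ 1)
  -2ℤ = - (+ 2)
  -3ℤ = - (+ 3)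

  rec12 : ∀ n → Sum± 5 1 (4 N.+ n) ≡ -3ℤ * Sum± 5 1 (3 N.+ n) + -2ℤ * Sum± 5 1 (2 N.+ n) + -1ℤ * Sum± 5 1 (1 N.+ n)
  rec12 = Sum±₁.rec 5

  -- multiplying a solution of a + 2c = 3b + d by alternating signs
  signed-rec : ∀ s a b c d → a + + 2 * c ≡ + 3 * b + d →
    (-1ℤ * (-1ℤ * (-1ℤ * s))) * a ≡ -3ℤ * ((-1ℤ * (-1ℤ * s)) * b) + -2ℤ * ((-1ℤ * s) * c) + -1ℤ * (s * d)
  signed-rec s a b c d h = trans (cong ((-1ℤ * (-1ℤ * (-1ℤ * s))) *_) solved) (identity s b c d)
    where
    solved : a ≡ + 3 * b + d - + 2 * c
    solved = trans (add-sub a c) (cong (_- + 2 * c) h)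
      where
      add-sub : ∀ a c → a ≡ a + + 2 * c - + 2 * c
      add-sub = solve-∀
    identity : ∀ s b c d → (-1ℤ * (-1ℤ * (-1ℤ * s))) * (+ 3 * b + d - + 2 * c)
                           ≡ -3ℤ * ((-1ℤ * (-1ℤ * s)) * b) + -2ℤ * ((-1ℤ * s) * c) + -1ℤ * (s * d)
    identity = solve-∀

  item12 : ∀ n → n ≥ 1 → Sum± 5 1 n ≡ sgn n * + Σ< ((n N.+ 1) / 2 N.+ 1) (λ i → (n N.+ 2 N.+ i) C (n N.+ 1 N.∸ 2 N.* i))
  item12 (suc m) _ = trans (agree m) (cong (λ z → sgn (suc m) * + z) (Y-closed-form (suc m)))
    where
    signedY : ℕ → ℤ
    signedY m = sgn (1 N.+ m) * + Y (1 N.+ m)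
    Y-rec : ∀ m → + Y (4 N.+ m) + + 2 * + Y (2 N.+ m) ≡ + 3 * + Y (3 N.+ m) + + Y (1 N.+ m)
    Y-rec m = trans (cong (_+_ (+ Y (4 N.+ m))) (sym (ZP.pos-* 2 (Y (2 N.+ m)))))
      (trans (sym (ZP.pos-+ (Y (4 N.+ m)) (2 N.* Y (2 N.+ m))))
      (trans (cong +_ (tri₁-rec (3 N.+ m)))
      (trans (ZP.pos-+ (3 N.* Y (3 N.+ m)) (Y (1 N.+ m))) (cong (_+ + Y (1 N.+ m)) (ZP.pos-* 3 (Y (3 N.+ m)))))))
    signedY-rec : ∀ m → signedY (3 N.+ m) ≡ -3ℤ * signedY (2 N.+ m) + -2ℤ * signedY (1 N.+ m) + -1ℤ * signedY m
    signedY-rec m = signed-rec (sgn (1 N.+ m)) (+ Y (4 N.+ m)) (+ Y (3 N.+ m)) (+ Y (2 N.+ m)) (+ Y (1 N.+ m)) (Y-rec m)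
    agree : ∀ m → Sum± 5 1 (1 N.+ m) ≡ signedY m
    agree = recurrence-unique (λ m → Sum± 5 1 (1 N.+ m)) signedY -3ℤ -2ℤ -1ℤ rec12 signedY-rec refl refl refl

-- Put W(m) = Σ_j 2^{m-3j} C(m-2j, j); Pascal's rule gives
-- W(m+3) = 2 W(m+2) + W(m).  Splitting the sum of item 9 by the parity of i
-- gives V(m+2) = W(m+1) + W(m), which satisfies the recurrence
-- S(n+4) = 2 S(n+3) + S(n+1) of Sum± 3 2; hence Sum± 3 2 n = -V(n).
module Item9Integer where

  open NatSums
  open Division using (quotient)
  open Recurrences using (recurrence-unique; module Sum±₂)
  open import Data.Nat as N using (ℕ; zero; suc; _≤_; _<_; _≥_; z≤n; s≤s; _/_; _^_)
  import Data.Nat.Properties as NP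
  import Data.Nat.DivMod as ND
  open import Data.Nat.Combinatorics using (_C_; k>n⇒nCk≡0)
  open import Data.Integer using (ℤ; +_; 0ℤ; _+_; _*_; -_)
  import Data.Integer.Properties as ZP
  open import Data.Integer.Tactic.RingSolver using (solve-∀)
  import Data.Nat.Tactic.RingSolver as ℕ-Solver
  open import Relation.Nullary using (yes; no)
  open import Relation.Binary.PropositionalEquality
  open ≡-Reasoning

  w : ℕ → ℕ → ℕ
  w m j = 2 ^ (m N.∸ 3 N.* j) N.* ((m N.∸ 2 N.* j) C j)

  W : ℕ → ℕ
  W m = Σ< (suc m) (w m)

  w-vanish : ∀ m j → suc m ≤ j → w m j ≡ 0
  w-vanish m j le = trans (cong (2 ^ (m N.∸ 3 N.* j) N.*_) (k>n⇒nCk≡0 (NP.≤-<-trans (NP.m∸n≤m m (2 N.* j)) le)))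
                          (NP.*-zeroʳ (2 ^ (m N.∸ 3 N.* j)))

  W-extend : ∀ N m → suc m ≤ N → Σ< N (w m) ≡ W m
  W-extend N m le = Σ<-truncate (suc m) N (w m) (w-vanish m) le

  -- 2^{m-3j} C(m-2j, j+1) = 2 · 2^{m-3j-1} C(m-2j, j+1): if 3j ≥ m the binomial vanishes
  halve-power : ∀ m j → 2 ^ (m N.∸ 3 N.* j) N.* ((m N.∸ 2 N.* j) C suc j)
                        ≡ 2 N.* (2 ^ (m N.∸ suc (3 N.* j)) N.* ((m N.∸ 2 N.* j) C suc j))
  halve-power m j with suc (3 N.* j) N.≤? m
  ... | yes le = trans (cong (λ z → 2 ^ z N.* ((m N.∸ 2 N.* j) C suc j)) exponent)
                       (NP.*-assoc 2 (2 ^ (m N.∸ suc (3 N.* j))) ((m N.∸ 2 N.* j) C suc j))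
    where
    exponent : m N.∸ 3 N.* j ≡ suc (m N.∸ suc (3 N.* j))
    exponent = trans (cong (N._∸ 3 N.* j) (sym (NP.m+[n∸m]≡n le)))
               (trans (NP.+-∸-comm {suc (3 N.* j)} (m N.∸ suc (3 N.* j)) (NP.n≤1+n _))
                      (cong (N._+ (m N.∸ suc (3 N.* j))) (NP.m+n∸n≡m 1 (3 N.* j))))
  ... | no nle = trans (cong (2 ^ (m N.∸ 3 N.* j) N.*_) zero-binomial)
      (trans (NP.*-zeroʳ (2 ^ (m N.∸ 3 N.* j))) (sym (trans (cong (λ u → 2 N.* (2 ^ (m N.∸ suc (3 N.* j)) N.* u)) zero-binomial)
                                        (cong (2 N.*_) (NP.*-zeroʳ (2 ^ (m N.∸ suc (3 N.* j))))))))
    where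
    split : ∀ j → 3 N.* j ≡ 2 N.* j N.+ j
    split = ℕ-Solver.solve-∀
    zero-binomial : (m N.∸ 2 N.* j) C suc j ≡ 0
    zero-binomial = k>n⇒nCk≡0 (s≤s (NP.m≤n+o⇒m∸n≤o m (2 N.* j) (NP.≤-trans (NP.≤-pred (NP.≰⇒> nle)) (NP.≤-reflexive (split j)))))

  w-step : ∀ m j → w (3 N.+ m) (suc j) ≡ 2 N.* w (2 N.+ m) (suc j) N.+ w m j
  w-step m j = begin
    2 ^ ((3 N.+ m) N.∸ 3 N.* suc j) N.* (((3 N.+ m) N.∸ 2 N.* suc j) C suc j)
      ≡⟨ cong₂ (λ u v → 2 ^ ((3 N.+ m) N.∸ u) N.* (((3 N.+ m) N.∸ v) C suc j)) (NP.*-suc 3 j) (NP.*-suc 2 j) ⟩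
    pw N.* (((1 N.+ m) N.∸ 2 N.* j) C suc j)
      ≡⟨ cong (pw N.*_) (pascal-∸ m (2 N.* j) j (positive-half m j)) ⟩
    pw N.* ((m N.∸ 2 N.* j) C suc j N.+ w₀)
      ≡⟨ NP.*-distribˡ-+ pw ((m N.∸ 2 N.* j) C suc j) w₀ ⟩
    pw N.* ((m N.∸ 2 N.* j) C suc j) N.+ pw N.* w₀
      ≡⟨ cong (N._+ w m j) (halve-power m j) ⟩
    2 N.* (2 ^ (m N.∸ suc (3 N.* j)) N.* ((m N.∸ 2 N.* j) C suc j)) N.+ w m j
      ≡⟨ cong₂ (λ u v → 2 N.* (2 ^ ((2 N.+ m) N.∸ u) N.* (((2 N.+ m) N.∸ v) C suc j)) N.+ w m j)
               (sym (NP.*-suc 3 j)) (sym (NP.*-suc 2 j)) ⟩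
    2 N.* w (2 N.+ m) (suc j) N.+ w m j ∎
    where
    pw = 2 ^ (m N.∸ 3 N.* j)
    w₀ = (m N.∸ 2 N.* j) C j

  W-rec : ∀ m → W (3 N.+ m) ≡ 2 N.* W (2 N.+ m) N.+ W m
  W-rec m = begin
    Σ< (4 N.+ m) (w (3 N.+ m))
      ≡⟨ Σ<-front (3 N.+ m) (w (3 N.+ m)) ⟩
    w (3 N.+ m) 0 N.+ Σ< (3 N.+ m) (λ j → w (3 N.+ m) (suc j))
      ≡⟨ cong₂ N._+_ (NP.*-assoc 2 (2 ^ (2 N.+ m)) 1)
                     (trans (Σ<-cong (3 N.+ m) (w-step m)) (Σ<-+ (3 N.+ m) (λ j → 2 N.* w (2 N.+ m) (suc j)) (w m))) ⟩
    2 N.* w (2 N.+ m) 0 N.+ (Σ< (3 N.+ m) (λ j → 2 N.* w (2 N.+ m) (suc j)) N.+ Σ< (3 N.+ m) (w m))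
      ≡⟨ cong (λ z → 2 N.* w (2 N.+ m) 0 N.+ (z N.+ Σ< (3 N.+ m) (w m))) (Σ<-scale (3 N.+ m) 2 (λ j → w (2 N.+ m) (suc j))) ⟩
    2 N.* w (2 N.+ m) 0 N.+ (2 N.* Σ< (3 N.+ m) (λ j → w (2 N.+ m) (suc j)) N.+ Σ< (3 N.+ m) (w m))
      ≡⟨ factor (w (2 N.+ m) 0) (Σ< (3 N.+ m) (λ j → w (2 N.+ m) (suc j))) (Σ< (3 N.+ m) (w m)) ⟩
    2 N.* (w (2 N.+ m) 0 N.+ Σ< (3 N.+ m) (λ j → w (2 N.+ m) (suc j))) N.+ Σ< (3 N.+ m) (w m)
      ≡⟨ cong₂ (λ u v → 2 N.* u N.+ v) (trans (sym (Σ<-front (3 N.+ m) (w (2 N.+ m)))) (W-extend (4 N.+ m) (2 N.+ m) (NP.n≤1+n _)))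
               (W-extend (3 N.+ m) m (NP.m≤n+m (suc m) 2)) ⟩
    2 N.* W (2 N.+ m) N.+ W m ∎
    where
    factor : ∀ a b c → 2 N.* a N.+ (2 N.* b N.+ c) ≡ 2 N.* (a N.+ b) N.+ c
    factor = ℕ-Solver.solve-∀

  -- the summands of item 9, cleared of denominators: 2^{n-1-i-⌊i/2⌋} C(n-1-i, ⌊i/2⌋)
  v : ℕ → ℕ → ℕ
  v n i = 2 ^ ((n N.∸ 1) N.∸ (i N.+ i / 2)) N.* ((n N.∸ 1 N.∸ i) C (i / 2))

  V : ℕ → ℕ
  V n = Σ< n (v n)

  half-even : ∀ j → (2 N.* j) / 2 ≡ j
  half-even j = trans (cong (_/ 2) (NP.*-comm 2 j)) (ND.m*n/n≡m j 2)

  half-odd : ∀ j → suc (2 N.* j) / 2 ≡ j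
  half-odd j = trans (cong (_/ 2) (cong suc (NP.*-comm 2 j))) (quotient 2 j 1 (s≤s (s≤s z≤n)))

  -- even-indexed summands of V(m+2) form W(m+1), odd-indexed ones W(m)
  V-split : ∀ m → V (2 N.+ m) ≡ W (1 N.+ m) N.+ W m
  V-split m = begin
    Σ< (2 N.+ m) (v (2 N.+ m))
      ≡⟨ sym (Σ<-truncate (2 N.+ m) (2 N.* (2 N.+ m)) (v (2 N.+ m)) vanish (NP.m≤n*m (2 N.+ m) 2)) ⟩
    Σ< (2 N.* (2 N.+ m)) (v (2 N.+ m))
      ≡⟨ Σ<-pairs (2 N.+ m) (v (2 N.+ m)) ⟩
    Σ< (2 N.+ m) (λ j → v (2 N.+ m) (2 N.* j) N.+ v (2 N.+ m) (suc (2 N.* j)))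
      ≡⟨ Σ<-cong (2 N.+ m) (λ j → cong₂ N._+_ (even j) (odd j)) ⟩
    Σ< (2 N.+ m) (λ j → w (1 N.+ m) j N.+ w m j)
      ≡⟨ Σ<-+ (2 N.+ m) (w (1 N.+ m)) (w m) ⟩
    W (1 N.+ m) N.+ Σ< (2 N.+ m) (w m)
      ≡⟨ cong (W (1 N.+ m) N.+_) (W-extend (2 N.+ m) m (NP.n≤1+n _)) ⟩
    W (1 N.+ m) N.+ W m ∎
    where
    triple : ∀ j → 2 N.* j N.+ j ≡ 3 N.* j
    triple = ℕ-Solver.solve-∀
    even : ∀ j → v (2 N.+ m) (2 N.* j) ≡ w (1 N.+ m) j
    even j = cong₂ (λ u k → 2 ^ ((1 N.+ m) N.∸ u) N.* (((1 N.+ m) N.∸ 2 N.* j) C k))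
                   (trans (cong (2 N.* j N.+_) (half-even j)) (triple j)) (half-even j)
    odd : ∀ j → v (2 N.+ m) (suc (2 N.* j)) ≡ w m j
    odd j = cong₂ (λ u k → 2 ^ (m N.∸ u) N.* ((m N.∸ 2 N.* j) C k))
                  (trans (cong (2 N.* j N.+_) (half-odd j)) (triple j)) (half-odd j)
    vanish : ∀ i → 2 N.+ m ≤ i → v (2 N.+ m) i ≡ 0
    vanish i le = trans (cong (2 ^ ((1 N.+ m) N.∸ (i N.+ i / 2)) N.*_)
                         (trans (cong (_C (i / 2)) (NP.m≤n⇒m∸n≡0 (NP.≤-trans (NP.n≤1+n (1 N.+ m)) le)))
                                (k>n⇒nCk≡0 (ND.m≥n⇒m/n>0 {i} {2} (NP.≤-trans (s≤s (s≤s z≤n)) le)))))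
                        (NP.*-zeroʳ (2 ^ ((1 N.+ m) N.∸ (i N.+ i / 2))))

  rec9 : ∀ n → Sum± 3 2 (4 N.+ n) ≡ + 2 * Sum± 3 2 (3 N.+ n) + 0ℤ * Sum± 3 2 (2 N.+ n) + + 1 * Sum± 3 2 (1 N.+ n)
  rec9 = Sum±₂.rec 3

  item9ℤ : ∀ n → n ≥ 1 → Sum± 3 2 n ≡ - (+ V n)
  item9ℤ (suc zero) _ = refl
  item9ℤ (suc (suc m)) _ = trans (agree m) (cong (λ z → - (+ z)) (sym (V-split m)))
    where
    X : ℕ → ℕ
    X m = W (1 N.+ m) N.+ W m
    X-rec : ∀ m → X (3 N.+ m) ≡ 2 N.* X (2 N.+ m) N.+ X m
    X-rec m = trans (cong₂ N._+_ (W-rec (1 N.+ m)) (W-rec m)) (collect (W (3 N.+ m)) (W (2 N.+ m)) (W (1 N.+ m)) (W m))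
      where
      collect : ∀ a b c d → (2 N.* a N.+ c) N.+ (2 N.* b N.+ d) ≡ 2 N.* (a N.+ b) N.+ (c N.+ d)
      collect = ℕ-Solver.solve-∀
    negX : ℕ → ℤ
    negX m = - (+ X m)
    negX-rec : ∀ m → negX (3 N.+ m) ≡ + 2 * negX (2 N.+ m) + 0ℤ * negX (1 N.+ m) + + 1 * negX m
    negX-rec m = trans (cong (λ z → - (+ z)) (X-rec m))
      (trans (cong -_ (trans (ZP.pos-+ (2 N.* X (2 N.+ m)) (X m)) (cong (_+ + X m) (ZP.pos-* 2 (X (2 N.+ m))))))
             (distrib (+ X (2 N.+ m)) (+ X m) (negX (1 N.+ m))))
      where
      distrib : ∀ a b c → - (+ 2 * a + b) ≡ + 2 * - a + 0ℤ * c + + 1 * - b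
      distrib = solve-∀
    agree : ∀ m → Sum± 3 2 (2 N.+ m) ≡ negX m
    agree = recurrence-unique (λ m → Sum± 3 2 (2 N.+ m)) negX (+ 2) 0ℤ (+ 1) (λ n → rec9 (suc n)) negX-rec refl refl refl

-- Item 9 over ℚ: 2^{n-1} · 2^{-i-⌊i/2⌋} C(n-1-i, ⌊i/2⌋) is the integer summand of V(n).
module Item9 where

  open NatSums
  open Item9Integer using (V; v; item9ℤ)
  open import Data.Nat as N using (ℕ; zero; suc; _≤_; _<_; _≥_; _/_; _^_)
  import Data.Nat.Properties as NP
  open import Data.Nat.Combinatorics using (_C_; k>n⇒nCk≡0)
  open import Data.Integer as Z using (ℤ; +_; 0ℤ)
  import Data.Integer.Properties as ZP
  open import Data.Rational as Q using (ℚ; 0ℚ; 1ℚ)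
  import Data.Rational.Properties as QP
  import Data.Rational.Unnormalised.Base as U
  import Data.Rational.Unnormalised.Properties as UP
  open import Relation.Nullary using (yes; no)
  open import Relation.Binary.PropositionalEquality
  open ≡-Reasoning

  ι : ℤ → ℚ
  ι x = x Q./ 1

  ι-unnormalised : ∀ x → Q.toℚᵘ (ι x) U.≃ U.mkℚᵘ x 0
  ι-unnormalised x = QP.toℚᵘ-fromℚᵘ (U.mkℚᵘ x 0)

  ι-* : ∀ x y → ι (x Z.* y) ≡ ι x Q.* ι y
  ι-* x y = QP.toℚᵘ-injective (UP.≃-trans (ι-unnormalised (x Z.* y))
    (UP.≃-trans (UP.*-cong (UP.≃-sym (ι-unnormalised x)) (UP.≃-sym (ι-unnormalised y))) (UP.≃-sym (QP.toℚᵘ-homo-* (ι x) (ι y)))))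

  ι-+ : ∀ x y → ι (x Z.+ y) ≡ ι x Q.+ ι y
  ι-+ x y = QP.toℚᵘ-injective (UP.≃-trans (ι-unnormalised (x Z.+ y)) (UP.≃-trans sum
    (UP.≃-trans (UP.+-cong (UP.≃-sym (ι-unnormalised x)) (UP.≃-sym (ι-unnormalised y))) (UP.≃-sym (QP.toℚᵘ-homo-+ (ι x) (ι y))))))
    where
    sum : U.mkℚᵘ (x Z.+ y) 0 U.≃ (U.mkℚᵘ x 0 U.+ U.mkℚᵘ y 0)
    sum = U.*≡* (cong (Z._* + 1) (cong₂ Z._+_ (sym (ZP.*-identityʳ x)) (sym (ZP.*-identityʳ y))))

  ι-neg : ∀ x → ι (Z.- x) ≡ Q.- ι x
  ι-neg x = QP.toℚᵘ-injective (UP.≃-trans (ι-unnormalised (Z.- x))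
    (UP.≃-trans (UP.-‿cong (UP.≃-sym (ι-unnormalised x))) (UP.≃-sym (QP.toℚᵘ-homo‿- (ι x)))))

  ι-0 : ι 0ℤ ≡ 0ℚ
  ι-0 = QP.0/n≡0 1

  inverse-cancel : ∀ k .{{_ : N.NonZero k}} → (+ 1 Q./ k) Q.* ι (+ k) ≡ 1ℚ
  inverse-cancel (suc k) = QP.toℚᵘ-injective (UP.≃-trans (QP.toℚᵘ-homo-* (+ 1 Q./ suc k) (ι (+ suc k)))
    (UP.≃-trans (UP.*-cong (QP.toℚᵘ-fromℚᵘ (U.mkℚᵘ (+ 1) k)) (ι-unnormalised (+ suc k))) (U.*≡* cross)))
    where
    cross : (+ 1 Z.* + suc k) Z.* + 1 ≡ + 1 Z.* + suc (k N.* 1)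
    cross = trans (ZP.*-identityʳ (+ 1 Z.* + suc k)) (trans (ZP.*-identityˡ (+ suc k))
              (sym (trans (ZP.*-identityˡ (+ suc (k N.* 1))) (cong (λ z → + suc z) (NP.*-identityʳ k)))))

  Σℚ-scale : ∀ n c (f : ℕ → ℚ) → c Q.* Σℚ< n f ≡ Σℚ< n (λ i → c Q.* f i)
  Σℚ-scale zero c f = QP.*-zeroʳ c
  Σℚ-scale (suc n) c f = trans (QP.*-distribˡ-+ c (Σℚ< n f) (f n)) (cong (Q._+ c Q.* f n) (Σℚ-scale n c f))

  Σℚ-cong< : ∀ n {f g : ℕ → ℚ} → (∀ i → i < n → f i ≡ g i) → Σℚ< n f ≡ Σℚ< n g
  Σℚ-cong< zero e = refl
  Σℚ-cong< (suc n) e = cong₂ Q._+_ (Σℚ-cong< n (λ i lt → e i (NP.m<n⇒m<1+n lt))) (e n NP.≤-refl)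

  Σℚ-ι : ∀ n (g : ℕ → ℕ) → Σℚ< n (λ i → ι (+ g i)) ≡ ι (+ Σ< n g)
  Σℚ-ι zero g = sym ι-0
  Σℚ-ι (suc n) g = trans (cong (Q._+ ι (+ g n)) (Σℚ-ι n g))
    (trans (sym (ι-+ (+ Σ< n g) (+ g n))) (cong ι (sym (ZP.pos-+ (Σ< n g) (g n)))))

  swap-outer : ∀ p q r s → (p Q.* q) Q.* (r Q.* s) ≡ (p Q.* s) Q.* (r Q.* q)
  swap-outer p q r s = begin
    (p Q.* q) Q.* (r Q.* s)  ≡⟨ QP.*-assoc p q (r Q.* s) ⟩
    p Q.* (q Q.* (r Q.* s))  ≡⟨ cong (p Q.*_) (trans (sym (QP.*-assoc q r s)) (trans (QP.*-comm (q Q.* r) s) (cong (s Q.*_) (QP.*-comm q r)))) ⟩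
    p Q.* (s Q.* (r Q.* q))  ≡⟨ sym (QP.*-assoc p s (r Q.* q)) ⟩
    (p Q.* s) Q.* (r Q.* q) ∎

  -- 2^a · 2^{-e} · c = 2^{a-e} · c  (when e > a, the binomial c = C(a-i, ⌊i/2⌋) is 0)
  summand : ∀ a i → i ≤ a →
    ι (+ (2 ^ a)) Q.* (2^- (i N.+ i / 2) Q.* ι (+ ((a N.∸ i) C (i / 2))))
      ≡ ι (+ (2 ^ (a N.∸ (i N.+ i / 2)) N.* ((a N.∸ i) C (i / 2))))
  summand a i i≤a with (i N.+ i / 2) N.≤? a
  ... | yes e≤a = begin
    ι (+ (2 ^ a)) Q.* (2^- e Q.* c)
      ≡⟨ cong (λ z → z Q.* (2^- e Q.* c)) (trans (cong (λ t → ι (+ t)) split-power)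
           (trans (cong ι (ZP.pos-* (2 ^ (a N.∸ e)) (2 ^ e))) (ι-* (+ (2 ^ (a N.∸ e))) (+ (2 ^ e))))) ⟩
    (ι (+ (2 ^ (a N.∸ e))) Q.* ι (+ (2 ^ e))) Q.* (2^- e Q.* c)
      ≡⟨ swap-outer (ι (+ (2 ^ (a N.∸ e)))) (ι (+ (2 ^ e))) (2^- e) c ⟩
    (ι (+ (2 ^ (a N.∸ e))) Q.* c) Q.* (2^- e Q.* ι (+ (2 ^ e)))
      ≡⟨ cong (ι (+ (2 ^ (a N.∸ e))) Q.* c Q.*_) (inverse-cancel (2 ^ e) {{NP.m^n≢0 2 e}}) ⟩
    (ι (+ (2 ^ (a N.∸ e))) Q.* c) Q.* 1ℚ
      ≡⟨ QP.*-identityʳ _ ⟩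
    ι (+ (2 ^ (a N.∸ e))) Q.* c
      ≡⟨ sym (trans (cong ι (ZP.pos-* (2 ^ (a N.∸ e)) ((a N.∸ i) C (i / 2)))) (ι-* (+ (2 ^ (a N.∸ e))) (+ ((a N.∸ i) C (i / 2))))) ⟩
    ι (+ (2 ^ (a N.∸ e) N.* ((a N.∸ i) C (i / 2)))) ∎
    where
    e = i N.+ i / 2
    c = ι (+ ((a N.∸ i) C (i / 2)))
    split-power : 2 ^ a ≡ 2 ^ (a N.∸ e) N.* 2 ^ e
    split-power = trans (cong (2 ^_) (sym (NP.m∸n+n≡m e≤a))) (NP.^-distribˡ-+-* 2 (a N.∸ e) e)
  ... | no e≰a = begin
    ι (+ (2 ^ a)) Q.* (2^- e Q.* ι (+ ((a N.∸ i) C (i / 2))))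
      ≡⟨ cong (λ z → ι (+ (2 ^ a)) Q.* (2^- e Q.* ι (+ z))) zero-binomial ⟩
    ι (+ (2 ^ a)) Q.* (2^- e Q.* ι 0ℤ)
      ≡⟨ cong (λ z → ι (+ (2 ^ a)) Q.* (2^- e Q.* z)) ι-0 ⟩
    ι (+ (2 ^ a)) Q.* (2^- e Q.* 0ℚ)
      ≡⟨ trans (cong (ι (+ (2 ^ a)) Q.*_) (QP.*-zeroʳ (2^- e))) (QP.*-zeroʳ (ι (+ (2 ^ a)))) ⟩
    0ℚ
      ≡⟨ sym (trans (cong (λ z → ι (+ z)) (NP.*-zeroʳ (2 ^ (a N.∸ e)))) ι-0) ⟩
    ι (+ (2 ^ (a N.∸ e) N.* 0))
      ≡⟨ cong (λ z → ι (+ (2 ^ (a N.∸ e) N.* z))) (sym zero-binomial) ⟩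
    ι (+ (2 ^ (a N.∸ e) N.* ((a N.∸ i) C (i / 2)))) ∎
    where
    e = i N.+ i / 2
    zero-binomial : (a N.∸ i) C (i / 2) ≡ 0
    zero-binomial = k>n⇒nCk≡0 (NP.+-cancelˡ-< i (a N.∸ i) (i / 2)
                      (subst (_< i N.+ i / 2) (sym (NP.m+[n∸m]≡n i≤a)) (NP.≰⇒> e≰a)))

  item9 : ∀ n → n ≥ 1 →
    (Sum± 3 2 n Q./ 1) ≡ Q.- ((+ (2 ^ (n N.∸ 1)) Q./ 1) Q.* Σℚ< n (λ i → 2^- (i N.+ i / 2) Q.* (+ ((n N.∸ 1 N.∸ i) C (i / 2)) Q./ 1)))
  item9 (suc a) le = begin
    ι (Sum± 3 2 (suc a))                  ≡⟨ cong ι (item9ℤ (suc a) le) ⟩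
    ι (Z.- (+ V (suc a)))                 ≡⟨ ι-neg (+ V (suc a)) ⟩
    Q.- ι (+ V (suc a))                   ≡⟨ cong Q.-_ (sym cleared) ⟩
    Q.- (ι (+ (2 ^ a)) Q.* Σℚ< (suc a) f) ∎
    where
    f : ℕ → ℚ
    f i = 2^- (i N.+ i / 2) Q.* ι (+ ((a N.∸ i) C (i / 2)))
    cleared : ι (+ (2 ^ a)) Q.* Σℚ< (suc a) f ≡ ι (+ V (suc a))
    cleared = trans (Σℚ-scale (suc a) (ι (+ (2 ^ a))) f)
              (trans (Σℚ-cong< (suc a) (λ i lt → summand a i (NP.≤-pred lt))) (Σℚ-ι (suc a) (v (suc a))))


open import Data.Nat using (ℕ; _+_; _*_; _∸_; _^_; _/_; _%_; _≥_)
open import Data.Nat.Combinatorics using (_C_)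
open import Data.Integer as ℤ using (ℤ; +_)
open import Data.Rational as ℚ using (ℚ)
open import Data.Product using (_×_; _,_)
open import Relation.Binary.PropositionalEquality using (_≡_)

theorem4 :
      (∀ n → n ≥ 2 → Sum± 0 1 n ≡ ℤ.- (+ F (n ∸ 2)))
    × (∀ n → n ≥ 1 → Sum⁺ 0 1 n ≡ + ((2 ^ n + 6) / 14))
    × (∀ n → n ≥ 2 →
         embed (+ (34 * 2 ^ (n ∸ 2)) ℤ.* Sum⁺ 0 2 n)
           ≡ (⟨ + 17 , + 1 ⟩ ⊗ (⟨ + 3 , + 1 ⟩ ^√ (n ∸ 2)))
             ⊕ (⟨ + 17 , ℤ.- (+ 1) ⟩ ⊗ (⟨ + 3 , ℤ.- (+ 1) ⟩ ^√ (n ∸ 2))))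
    × (∀ n → n ≥ 1 → Sum± 1 1 n ≡ ℤ.- (+ Σ< ((n + 1) / 3) (λ i → (n ∸ 2 ∸ 2 * i) C i)))
    × (∀ n → n ≥ 2 → Sum⁺ 1 1 n ≡ + Σ< ((2 * n ∸ 4) / 3 + 1) (λ i → (2 * n ∸ 4 ∸ 2 * i) C i))
    × (∀ n → n ≥ 1 → Sum± 1 2 n ≡ ℤ.- (+ ((4 * 3 ^ n) / 27)))
    × (∀ n → n ≥ 1 → Sum± 2 1 n ≡ ℤ.- (+ P (n + 2)))
    × (∀ n → n ≥ 4 → Sum± 3 1 n ≡ + 0)
    × (∀ n → n ≥ 1 →
         (Sum± 3 2 n ℚ./ 1)
           ≡ ℚ.- ((+ (2 ^ (n ∸ 1)) ℚ./ 1)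
                  ℚ.* Σℚ< n (λ i → 2^- (i + i / 2) ℚ.* (+ ((n ∸ 1 ∸ i) C (i / 2)) ℚ./ 1))))
    × (∀ n → n ≥ 2 →
         (n % 3 ≡ 0 → Sum± 4 1 n ≡ + 1)
       × (n % 3 ≡ 1 → Sum± 4 1 n ≡ ℤ.- (+ 1))
       × (n % 3 ≡ 2 → Sum± 4 1 n ≡ + 0))
    × (∀ n → n ≥ 3 → Sum± 4 2 n ≡ ℤ.- (+ 4))
    × (∀ n → n ≥ 1 →
         Sum± 5 1 n ≡ sgn n ℤ.* + Σ< ((n + 1) / 2 + 1) (λ i → (n + 2 + i) C (n + 1 ∸ 2 * i)))
    × (∀ n → n ≥ 3 → Sum± 5 2 n ≡ + 4 ℤ.* sgn n)
theorem4 =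
    ClosedForms.item1
  , PowerFormulas.item2
  , PowerFormulas.item3
  , SkewBinomialItems.item4
  , SkewBinomialItems.item5
  , ClosedForms.item6
  , ClosedForms.item7
  , ClosedForms.item8
  , Item9.item9
  , ClosedForms.item10
  , ClosedForms.item11
  , Item12.item12
  , ClosedForms.item13
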